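{- Let $G$ be a finite simple undirected graph, $\mathcal{M}$ an MCB of $G$, and let distinct cycles $C_1,C_2\in\mathcal{M}$ share at least two vertices. Then there exists a cycle $C_1'$ such that (1) $\mathcal{M}'=(\mathcal{M}\setminus\{C_1\})\cup\{C_1'\}$ is an MCB, and (2) the intersection of $C_1'$ and $C_2$ (common vertices and edges) is a single path.
   Context: Let $G=(V,E)$ be a finite simple undirected graph. A cycle is a set $C\subseteq E$ such that every vertex of $G$ has even degree in the subgraph with edge set $C$; $|C|$ denotes its number of edges. The cycles form a vector space over $GF(2)$ under symmetric difference $\oplus$. A minimum cycle basis (MCB) is a basis $\mathcal{M}$ of this space minimizing $\sum_{B\in\mathcal{M}}|B|$. Elements of an MCB are edge sets of simple cycles (circuits) of $G$. -}

module Defs where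

open import Data.Nat using (ℕ; zero; suc; _≤_)
open import Data.Nat.Divisibility using (_∣_)
open import Data.Bool using (Bool; true; false; _xor_; _∧_; _∨_; if_then_else_)
open import Data.Fin using (Fin; zero; suc; inject₁; _≟_)
open import Data.Fin.Subset using (Subset; ⊥; _∈_; _∩_; ∣_∣)
open import Data.Vec using (Vec; []; _∷_; zipWith; lookup)
open import Data.List using (map; allFin)
open import Data.Nat.ListAction using (sum)
open import Data.Product using (Σ; ∃; ∃-syntax; _×_; _,_; proj₁; proj₂)
open import Data.Sum using (_⊎_)
open import Relation.Nullary using (¬_; does)
open import Relation.Binary.PropositionalEquality using (_≡_; _≢_)
open import Function using (_∘_; _⇔_)
open import Function.Definitions using (Injective)

record Graph : Set where
  field
    n     : ℕ
    m     : ℕ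
    ends  : Fin m → Fin n × Fin n
    loopless : ∀ e → proj₁ (ends e) ≢ proj₂ (ends e)

  Joins : Fin m → Fin n → Fin n → Set
  Joins e u v = (ends e ≡ (u , v)) ⊎ (ends e ≡ (v , u))

  field
    simple : ∀ e f u v → Joins e u v → Joins f u v → e ≡ f

  Incident : Fin n → Fin m → Set
  Incident v e = (proj₁ (ends e) ≡ v) ⊎ (proj₂ (ends e) ≡ v)

  incident? : Fin n → Fin m → Bool
  incident? v e = does (proj₁ (ends e) ≟ v) ∨ does (proj₂ (ends e) ≟ v)

  EdgeSet : Set
  EdgeSet = Subset m

  deg : EdgeSet → Fin n → ℕ
  deg C v = sum (map (λ e → if lookup C e ∧ incident? v e then 1 else 0) (allFin m))

  IsCycle : EdgeSet → Set
  IsCycle C = ∀ v → 2 ∣ deg C v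

  _∈V_ : Fin n → EdgeSet → Set
  v ∈V C = ∃[ e ] (e ∈ C × Incident v e)

_⊕_ : ∀ {m} → Subset m → Subset m → Subset m
_⊕_ = zipWith _xor_

lincomb : ∀ {m k} → (Fin k → Subset m) → Vec Bool k → Subset m
lincomb {k = zero}  B []      = ⊥
lincomb {k = suc k} B (b ∷ c) = (if b then B zero else ⊥) ⊕ lincomb (B ∘ suc) c

module _ (G : Graph) where
  open Graph G

  IsCycleBasis : ∀ {k} → (Fin k → EdgeSet) → Set
  IsCycleBasis {k} B =
    (∀ i → IsCycle (B i)) ×
    (∀ (c : Vec Bool k) → lincomb B c ≡ ⊥ → c ≡ ⊥) ×
    (∀ C → IsCycle C → ∃[ c ] lincomb B c ≡ C)

  weight : ∀ {k} → (Fin k → EdgeSet) → ℕ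
  weight {k} B = sum (map (λ i → ∣ B i ∣) (allFin k))

  IsMCB : ∀ {k} → (Fin k → EdgeSet) → Set
  IsMCB B = IsCycleBasis B × (∀ {k'} (B' : Fin k' → EdgeSet) → IsCycleBasis B' → weight B ≤ weight B')

  IntersectionIsPath : EdgeSet → EdgeSet → Set
  IntersectionIsPath C D =
    Σ ℕ λ len →
    Σ (Fin (suc len) → Fin n) λ vs →
    Σ (Fin len → Fin m) λ es →
      Injective _≡_ _≡_ vs ×
      (∀ i → Joins (es i) (vs (inject₁ i)) (vs (suc i))) ×
      (∀ v → ((v ∈V C) × (v ∈V D)) ⇔ (∃[ i ] vs i ≡ v)) ×
      (∀ e → (e ∈ (C ∩ D)) ⇔ (∃[ i ] es i ≡ e))

-- (M ∖ {M i}) ∪ {C} as an indexed family: replace the i-th member by C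
replaceAt : ∀ {A : Set} {k} → (Fin k → A) → Fin k → A → (Fin k → A)
replaceAt M i C l = if does (l ≟ i) then C else M l

{-# OPTIONS --safe #-}
module Submission where

-- Write + for symmetric difference, C₁ = M i and C₂ = M j.  Call a cycle D a candidate if it
-- can replace C₁ in the MCB (its expansion in M uses C₁ and |D| ≤ |C₁|, so the exchange is
-- again an MCB) and it shares two distinct vertices with C₂; C₁ itself is one.  A candidate is
-- a circuit not contained in C₂, so it has an ear: a path P ⊆ D through an edge outside C₂
-- that meets C₂ only in its ends x ≠ y.  These split C₂ into arcs R and S; the cycles P + R
-- and P + S add up to C₂, hence have the same C₁-coefficient.  If it is 1, then
-- (D + P + R) + (D + P + S) = C₂ shows that one arc, say S, is no longer than D − P, so P + S
-- replaces C₁ and meets C₂ in the single path S.  If it is 0, then (P + R) + (P + S) = C₂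
-- shows that one arc, say S, is no longer than P, and D + P + S is a candidate sharing more
-- edges with C₂; so the process ends.

open import Defs
open import Algebra.Bundles using (CommutativeRing; CommutativeMonoid)
import Algebra.Properties.CommutativeSemigroup as CommutativeSemigroupProperties
open import Data.Bool using (Bool; true; false; not; _∧_; _∨_; _xor_; if_then_else_)
import Data.Bool as Bool
open import Data.Bool.Properties
  using ( xor-assoc; xor-comm; xor-same; xor-identityˡ; xor-identityʳ; xor-∧-commutativeRing
        ; not-involutive; not-distribˡ-xor; ∧-distribʳ-xor; ∧-conicalˡ; ∧-conicalʳ)
open import Data.Empty using (⊥-elim) renaming (⊥ to Empty)
open import Data.Fin using (Fin; zero; suc; _≟_; inject₁)
open import Data.Fin.Properties using (any?; suc-injective)
open import Data.Fin.Subset using (Subset; ⊥; ⁅_⁆; _∈_; _∩_; _⊆_; ∣_∣)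
open import Data.Fin.Subset.Properties using (_∈?_; ∣⊥∣≡0; ∣p∩q∣≤∣q∣; p⊂q⇒∣p∣<∣q∣)
open import Data.List using (map; allFin; tabulate)
open import Data.List.Properties using (map-tabulate; map-cong)
open import Data.Nat using (ℕ; zero; suc; _+_; _*_; _∸_; _≤_; _<_)
open import Data.Nat.Divisibility using (_∣_; divides)
open import Data.Nat.Induction using (<-wellFounded)
open import Data.Nat.ListAction using (sum)
open import Data.Nat.Properties
  using ( ≤-refl; ≤-trans; <⇒≱; n≮0; n≤0⇒n≡0; m≤m+n; ∸-monoʳ-<; *-suc; +-suc; +-assoc; +-comm; +-identityʳ
        ; +-cancelˡ-≤; +-cancelʳ-≤; +-monoˡ-≤; +-monoʳ-≤; module ≤-Reasoning)
open import Data.Product using (Σ; ∃-syntax; _×_; _,_; proj₁; proj₂)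
open import Data.Sum using (_⊎_; inj₁; inj₂; [_,_])
open import Data.Unit using (⊤; tt)
open import Data.Vec using (Vec; []; _∷_; lookup)
import Data.Vec as Vec
open import Data.Vec.Properties
  using ( lookup⇒[]=; []=⇒lookup; lookup-zipWith; lookup-replicate; tabulate∘lookup; tabulate-cong
        ; zipWith-assoc; zipWith-comm; zipWith-identityˡ; zipWith-identityʳ)
open import Function using (_∘_; id; _⇔_; mk⇔; Equivalence)
open import Function.Properties.Equivalence using () renaming (trans to ⇔-trans)
open import Induction.WellFounded using (Acc; acc)
open import Relation.Nullary using (¬_; Dec; does; yes; no)
open import Relation.Nullary.Decidable using (dec-true; dec-false; _×-dec_; _⊎-dec_)
open import Relation.Unary using (Decidable)
open import Relation.Binary.PropositionalEquality hiding ([_])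

private
  variable
    d k : ℕ

true≢false : true ≢ false
true≢false ()

xor-interchange : ∀ a b c d → (a xor b) xor (c xor d) ≡ (a xor c) xor (b xor d)
xor-interchange = interchange
  where
  open CommutativeSemigroupProperties
         (CommutativeMonoid.commutativeSemigroup (CommutativeRing.+-commutativeMonoid xor-∧-commutativeRing))

xor-telescope : ∀ a b c → (a xor b) xor (b xor c) ≡ a xor c
xor-telescope a b c = begin
  (a xor b) xor (b xor c) ≡⟨ xor-assoc a b (b xor c) ⟩
  a xor (b xor (b xor c)) ≡⟨ cong (a xor_) (xor-assoc b b c) ⟨
  a xor ((b xor b) xor c) ≡⟨ cong (λ t → a xor (t xor c)) (xor-same b) ⟩
  a xor c                 ∎
  where open ≡-Reasoning

xor-cancelˡ-shared : ∀ a b c → (a xor b) xor (a xor c) ≡ b xor c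
xor-cancelˡ-shared a b c = begin
  (a xor b) xor (a xor c) ≡⟨ xor-interchange a b a c ⟩
  (a xor a) xor (b xor c) ≡⟨ cong (_xor (b xor c)) (xor-same a) ⟩
  b xor c                 ∎
  where open ≡-Reasoning

xor≡false⇒≡ : ∀ {a b} → a xor b ≡ false → a ≡ b
xor≡false⇒≡ {true}  {true}  _ = refl
xor≡false⇒≡ {false} {false} _ = refl

xor≡true⇒¬ʳ : ∀ {a b} → a xor b ≡ true → a ≡ true → b ≡ false
xor≡true⇒¬ʳ {true} {false} _ _ = refl

xor≡true⇒⊎ : ∀ {a b} → a xor b ≡ true → a ≡ true ⊎ b ≡ true
xor≡true⇒⊎ {true}          _ = inj₁ refl
xor≡true⇒⊎ {false} {true}  _ = inj₂ refl

-- Parity and sums over Fin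

odd : ℕ → Bool
odd zero    = false
odd (suc a) = not (odd a)

odd-+ : ∀ a b → odd (a + b) ≡ odd a xor odd b
odd-+ zero    b = refl
odd-+ (suc a) b = trans (cong not (odd-+ a b)) (not-distribˡ-xor (odd a) (odd b))

2∣⇒¬odd : ∀ {a} → 2 ∣ a → odd a ≡ false
2∣⇒¬odd (divides q refl) = even-q*2 q
  where
  even-q*2 : ∀ q → odd (q * 2) ≡ false
  even-q*2 zero    = refl
  even-q*2 (suc q) = trans (not-involutive _) (even-q*2 q)

¬odd⇒2∣ : ∀ a → odd a ≡ false → 2 ∣ a
¬odd⇒2∣ zero          _ = divides 0 refl
¬odd⇒2∣ (suc (suc a)) p with ¬odd⇒2∣ a (trans (sym (not-involutive _)) p)
... | divides q a≡q*2 = divides (suc q) (cong (2 +_) a≡q*2)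

m+2n≤m⇒n≡0 : ∀ m n → m + 2 * n ≤ m → n ≡ 0
m+2n≤m⇒n≡0 m n m+2n≤m = n≤0⇒n≡0 (≤-trans (m≤m+n n (n + 0)) 2n≤0)
  where
  2n≤0 : 2 * n ≤ 0
  2n≤0 = +-cancelˡ-≤ m _ 0 (subst (m + 2 * n ≤_) (sym (+-identityʳ m)) m+2n≤m)

∑ : ∀ {k} → (Fin k → ℕ) → ℕ
∑ {k} f = sum (map f (allFin k))

∑-suc : ∀ {k} (f : Fin (suc k) → ℕ) → ∑ f ≡ f zero + ∑ (f ∘ suc)
∑-suc {k} f = cong (λ fs → f zero + sum fs) (trans (map-tabulate suc f) (sym (map-tabulate id (f ∘ suc))))

∑-cong : ∀ {k} {f g : Fin k → ℕ} → (∀ l → f l ≡ g l) → ∑ f ≡ ∑ g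
∑-cong {k} f≗g = cong sum (map-cong f≗g (allFin k))

xorSum : ∀ {k} → (Fin k → Bool) → Bool
xorSum {zero}  b = false
xorSum {suc k} b = b zero xor xorSum (b ∘ suc)

odd-∑ : ∀ {k} (f : Fin k → ℕ) → odd (∑ f) ≡ xorSum (odd ∘ f)
odd-∑ {zero}  f = refl
odd-∑ {suc k} f = begin
  odd (∑ f)                         ≡⟨ cong odd (∑-suc f) ⟩
  odd (f zero + ∑ (f ∘ suc))        ≡⟨ odd-+ (f zero) _ ⟩
  odd (f zero) xor odd (∑ (f ∘ suc)) ≡⟨ cong (odd (f zero) xor_) (odd-∑ (f ∘ suc)) ⟩
  xorSum (odd ∘ f)                  ∎
  where open ≡-Reasoning

xorSum-cong : ∀ {k} {b c : Fin k → Bool} → (∀ e → b e ≡ c e) → xorSum b ≡ xorSum c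
xorSum-cong {zero}  b≗c = refl
xorSum-cong {suc k} b≗c = cong₂ _xor_ (b≗c zero) (xorSum-cong (b≗c ∘ suc))

xorSum-xor : ∀ {k} (b c : Fin k → Bool) → xorSum (λ e → b e xor c e) ≡ xorSum b xor xorSum c
xorSum-xor {zero}  b c = refl
xorSum-xor {suc k} b c = trans (cong ((b zero xor c zero) xor_) (xorSum-xor (b ∘ suc) (c ∘ suc)))
                               (xor-interchange (b zero) (c zero) _ _)

xorSum-false : ∀ {k} (b : Fin k → Bool) → (∀ e → b e ≡ false) → xorSum b ≡ false
xorSum-false {zero}  b b≗false = refl
xorSum-false {suc k} b b≗false = cong₂ _xor_ (b≗false zero) (xorSum-false (b ∘ suc) (b≗false ∘ suc))

xorSum≡true⇒∃ : ∀ {k} (b : Fin k → Bool) → xorSum b ≡ true → ∃[ e ] b e ≡ true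
xorSum≡true⇒∃ {suc k} b p with b zero in b₀
... | true  = zero , b₀
... | false = let e , bₑ = xorSum≡true⇒∃ (b ∘ suc) p in suc e , bₑ

xorSum-⁅⁆ : ∀ {k} (f : Fin k) (b : Fin k → Bool) → xorSum (λ e → does (f ≟ e) ∧ b e) ≡ b f
xorSum-⁅⁆ {suc k} zero    b = trans (cong (b zero xor_) (xorSum-false {k} _ (λ _ → refl))) (xor-identityʳ (b zero))
xorSum-⁅⁆ {suc k} (suc f) b = xorSum-⁅⁆ f (b ∘ suc)

-- Edge sets as vectors over GF(2)

-- Subsets are handled through `lookup X e : Bool`, in which ⊕ is pointwise xor.
_⊆ᵇ_ : Subset d → Subset d → Set
X ⊆ᵇ Y = ∀ e → lookup X e ≡ true → lookup Y e ≡ true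

Disjoint : Subset d → Subset d → Set
Disjoint X Y = ∀ e → lookup X e ≡ true → lookup Y e ≡ false

Disjoint-sym : ∀ (X Y : Subset d) → Disjoint X Y → Disjoint Y X
Disjoint-sym X Y X#Y e Ye with lookup X e in Xe
... | false = refl
... | true  = ⊥-elim (true≢false (trans (sym Ye) (X#Y e Xe)))

lookup-⊕ : ∀ (X Y : Subset d) e → lookup (X ⊕ Y) e ≡ lookup X e xor lookup Y e
lookup-⊕ X Y e = lookup-zipWith _xor_ e X Y

lookup-∩ : ∀ (X Y : Subset d) e → lookup (X ∩ Y) e ≡ lookup X e ∧ lookup Y e
lookup-∩ X Y e = lookup-zipWith _∧_ e X Y

lookup-⊥ : ∀ (e : Fin d) → lookup ⊥ e ≡ false
lookup-⊥ e = lookup-replicate e false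

lookup-⁅⁆ : ∀ (f e : Fin d) → lookup ⁅ f ⁆ e ≡ does (f ≟ e)
lookup-⁅⁆ zero    zero    = refl
lookup-⁅⁆ zero    (suc e) = lookup-⊥ e
lookup-⁅⁆ (suc f) zero    = refl
lookup-⁅⁆ (suc f) (suc e) = lookup-⁅⁆ f e

lookup-⁅⁆⊕-≢ : ∀ {f e : Fin d} (X : Subset d) → f ≢ e → lookup (⁅ f ⁆ ⊕ X) e ≡ lookup X e
lookup-⁅⁆⊕-≢ {f = f} {e} X f≢e =
  trans (lookup-⊕ ⁅ f ⁆ X e) (cong (_xor lookup X e) (trans (lookup-⁅⁆ f e) (dec-false (f ≟ e) f≢e)))

lookup-⁅⁆⊕-same : ∀ (f : Fin d) (X : Subset d) → lookup (⁅ f ⁆ ⊕ X) f ≡ not (lookup X f)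
lookup-⁅⁆⊕-same f X = trans (lookup-⊕ ⁅ f ⁆ X f) (cong (_xor lookup X f) (trans (lookup-⁅⁆ f f) (dec-true (f ≟ f) refl)))

subset-ext : ∀ {X Y : Subset d} → (∀ e → lookup X e ≡ lookup Y e) → X ≡ Y
subset-ext {X = X} {Y = Y} h = begin
  X                       ≡⟨ tabulate∘lookup X ⟨
  Vec.tabulate (lookup X) ≡⟨ tabulate-cong h ⟩
  Vec.tabulate (lookup Y) ≡⟨ tabulate∘lookup Y ⟩
  Y                       ∎
  where open ≡-Reasoning

⊕-assoc : ∀ (X Y Z : Subset d) → (X ⊕ Y) ⊕ Z ≡ X ⊕ (Y ⊕ Z)
⊕-assoc = zipWith-assoc xor-assoc

⊕-comm : ∀ (X Y : Subset d) → X ⊕ Y ≡ Y ⊕ X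
⊕-comm = zipWith-comm xor-comm

⊕-identityˡ : ∀ (X : Subset d) → ⊥ ⊕ X ≡ X
⊕-identityˡ = zipWith-identityˡ xor-identityˡ

⊕-identityʳ : ∀ (X : Subset d) → X ⊕ ⊥ ≡ X
⊕-identityʳ = zipWith-identityʳ xor-identityʳ

⊕-self : ∀ (X : Subset d) → X ⊕ X ≡ ⊥
⊕-self X = subset-ext λ e → trans (lookup-⊕ X X e) (trans (xor-same (lookup X e)) (sym (lookup-⊥ e)))

⊕-cancelʳ : ∀ (X Y : Subset d) → (X ⊕ Y) ⊕ Y ≡ X
⊕-cancelʳ X Y = begin
  (X ⊕ Y) ⊕ Y ≡⟨ ⊕-assoc X Y Y ⟩
  X ⊕ (Y ⊕ Y) ≡⟨ cong (X ⊕_) (⊕-self Y) ⟩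
  X ⊕ ⊥       ≡⟨ ⊕-identityʳ X ⟩
  X           ∎
  where open ≡-Reasoning

⊕-cancelˡ : ∀ (X Y : Subset d) → X ⊕ (X ⊕ Y) ≡ Y
⊕-cancelˡ X Y = begin
  X ⊕ (X ⊕ Y) ≡⟨ ⊕-assoc X X Y ⟨
  (X ⊕ X) ⊕ Y ≡⟨ cong (_⊕ Y) (⊕-self X) ⟩
  ⊥ ⊕ Y       ≡⟨ ⊕-identityˡ Y ⟩
  Y           ∎
  where open ≡-Reasoning

⊕≡⊥⇒≡ : ∀ {X Y : Subset d} → X ⊕ Y ≡ ⊥ → X ≡ Y
⊕≡⊥⇒≡ {X = X} {Y = Y} eq = begin
  X           ≡⟨ ⊕-cancelʳ X Y ⟨
  (X ⊕ Y) ⊕ Y ≡⟨ cong (_⊕ Y) eq ⟩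
  ⊥ ⊕ Y       ≡⟨ ⊕-identityˡ Y ⟩
  Y           ∎
  where open ≡-Reasoning

⊕-interchange : ∀ (W X Y Z : Subset d) → (W ⊕ X) ⊕ (Y ⊕ Z) ≡ (W ⊕ Y) ⊕ (X ⊕ Z)
⊕-interchange W X Y Z = begin
  (W ⊕ X) ⊕ (Y ⊕ Z) ≡⟨ ⊕-assoc W X (Y ⊕ Z) ⟩
  W ⊕ (X ⊕ (Y ⊕ Z)) ≡⟨ cong (W ⊕_) (⊕-assoc X Y Z) ⟨
  W ⊕ ((X ⊕ Y) ⊕ Z) ≡⟨ cong (λ T → W ⊕ (T ⊕ Z)) (⊕-comm X Y) ⟩
  W ⊕ ((Y ⊕ X) ⊕ Z) ≡⟨ cong (W ⊕_) (⊕-assoc Y X Z) ⟩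
  W ⊕ (Y ⊕ (X ⊕ Z)) ≡⟨ ⊕-assoc W Y (X ⊕ Z) ⟨
  (W ⊕ Y) ⊕ (X ⊕ Z) ∎
  where open ≡-Reasoning

⊕-⊆ᵇ : ∀ (A B X : Subset d) → A ⊆ᵇ X → B ⊆ᵇ X → (A ⊕ B) ⊆ᵇ X
⊕-⊆ᵇ A B X A⊆X B⊆X e A⊕Be with xor≡true⇒⊎ (trans (sym (lookup-⊕ A B e)) A⊕Be)
... | inj₁ Ae = A⊆X e Ae
... | inj₂ Be = B⊆X e Be

⁅⁆⊆ᵇ : ∀ {f : Fin d} (X : Subset d) → lookup X f ≡ true → ⁅ f ⁆ ⊆ᵇ X
⁅⁆⊆ᵇ {f = f} X Xf e ⁅f⁆e with f ≟ e
... | yes refl = Xf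
... | no f≢e   = ⊥-elim (true≢false (trans (sym ⁅f⁆e) (trans (lookup-⁅⁆ f e) (dec-false (f ≟ e) f≢e))))

∣X⊕Y∣+2∣X∩Y∣≡∣X∣+∣Y∣ : ∀ (X Y : Subset d) → ∣ X ⊕ Y ∣ + 2 * ∣ X ∩ Y ∣ ≡ ∣ X ∣ + ∣ Y ∣
∣X⊕Y∣+2∣X∩Y∣≡∣X∣+∣Y∣ [] [] = refl
∣X⊕Y∣+2∣X∩Y∣≡∣X∣+∣Y∣ (x ∷ X) (y ∷ Y) = step x y (∣X⊕Y∣+2∣X∩Y∣≡∣X∣+∣Y∣ X Y)
  where
  open ≡-Reasoning
  step : ∀ x y → ∣ X ⊕ Y ∣ + 2 * ∣ X ∩ Y ∣ ≡ ∣ X ∣ + ∣ Y ∣ →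
         ∣ (x ∷ X) ⊕ (y ∷ Y) ∣ + 2 * ∣ (x ∷ X) ∩ (y ∷ Y) ∣ ≡ ∣ x ∷ X ∣ + ∣ y ∷ Y ∣
  step true  true  eq = begin
    ∣ X ⊕ Y ∣ + 2 * suc ∣ X ∩ Y ∣           ≡⟨ cong (∣ X ⊕ Y ∣ +_) (*-suc 2 ∣ X ∩ Y ∣) ⟩
    ∣ X ⊕ Y ∣ + suc (suc (2 * ∣ X ∩ Y ∣))   ≡⟨ +-suc ∣ X ⊕ Y ∣ _ ⟩
    suc (∣ X ⊕ Y ∣ + suc (2 * ∣ X ∩ Y ∣))   ≡⟨ cong suc (+-suc ∣ X ⊕ Y ∣ _) ⟩
    suc (suc (∣ X ⊕ Y ∣ + 2 * ∣ X ∩ Y ∣))   ≡⟨ cong (2 +_) eq ⟩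
    suc (suc (∣ X ∣ + ∣ Y ∣))               ≡⟨ cong suc (+-suc ∣ X ∣ ∣ Y ∣) ⟨
    suc (∣ X ∣ + suc ∣ Y ∣)                 ∎
  step true  false eq = cong suc eq
  step false true  eq = trans (cong suc eq) (sym (+-suc ∣ X ∣ ∣ Y ∣))
  step false false eq = eq

∣X⊕Y∣≤∣X∣+∣Y∣ : ∀ (X Y : Subset d) → ∣ X ⊕ Y ∣ ≤ ∣ X ∣ + ∣ Y ∣
∣X⊕Y∣≤∣X∣+∣Y∣ X Y = subst (∣ X ⊕ Y ∣ ≤_) (∣X⊕Y∣+2∣X∩Y∣≡∣X∣+∣Y∣ X Y) (m≤m+n _ _)

Disjoint⇒∩≡⊥ : ∀ (X Y : Subset d) → Disjoint X Y → X ∩ Y ≡ ⊥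
Disjoint⇒∩≡⊥ X Y X#Y = subset-ext pointwise
  where
  pointwise : ∀ e → lookup (X ∩ Y) e ≡ lookup ⊥ e
  pointwise e with lookup X e in Xe
  ... | true  = trans (lookup-∩ X Y e) (trans (cong (_∧ lookup Y e) Xe) (trans (X#Y e Xe) (sym (lookup-⊥ e))))
  ... | false = trans (lookup-∩ X Y e) (trans (cong (_∧ lookup Y e) Xe) (sym (lookup-⊥ e)))

Disjoint⇒∣X⊕Y∣≡∣X∣+∣Y∣ : ∀ (X Y : Subset d) → Disjoint X Y → ∣ X ⊕ Y ∣ ≡ ∣ X ∣ + ∣ Y ∣
Disjoint⇒∣X⊕Y∣≡∣X∣+∣Y∣ {d} X Y X#Y = begin
  ∣ X ⊕ Y ∣                     ≡⟨ +-identityʳ ∣ X ⊕ Y ∣ ⟨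
  ∣ X ⊕ Y ∣ + 2 * 0             ≡⟨ cong (λ t → ∣ X ⊕ Y ∣ + 2 * t) ∣X∩Y∣≡0 ⟨
  ∣ X ⊕ Y ∣ + 2 * ∣ X ∩ Y ∣     ≡⟨ ∣X⊕Y∣+2∣X∩Y∣≡∣X∣+∣Y∣ X Y ⟩
  ∣ X ∣ + ∣ Y ∣                 ∎
  where
  open ≡-Reasoning
  ∣X∩Y∣≡0 : ∣ X ∩ Y ∣ ≡ 0
  ∣X∩Y∣≡0 = trans (cong ∣_∣ (Disjoint⇒∩≡⊥ X Y X#Y)) (∣⊥∣≡0 d)

⊆ᵇ⇒⊆ : ∀ {X Y : Subset d} → X ⊆ᵇ Y → X ⊆ Y
⊆ᵇ⇒⊆ {Y = Y} X⊆Y {e} e∈X = lookup⇒[]= e Y (X⊆Y e ([]=⇒lookup e∈X))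

⊆ᵇ⇒∣X∣<∣Y∣ : ∀ (X Y : Subset d) → X ⊆ᵇ Y →
             ∀ e → lookup Y e ≡ true → lookup X e ≡ false → ∣ X ∣ < ∣ Y ∣
⊆ᵇ⇒∣X∣<∣Y∣ X Y X⊆Y e Ye Xe = p⊂q⇒∣p∣<∣q∣ (⊆ᵇ⇒⊆ {X = X} {Y} X⊆Y , e , lookup⇒[]= e Y Ye , e∉X)
  where
  e∉X : ¬ e ∈ X
  e∉X e∈X = true≢false (trans (sym ([]=⇒lookup e∈X)) Xe)

0<∣X∣ : ∀ (X : Subset d) e → lookup X e ≡ true → 0 < ∣ X ∣
0<∣X∣ {d} X e Xe = subst (_< ∣ X ∣) (∣⊥∣≡0 d) (⊆ᵇ⇒∣X∣<∣Y∣ ⊥ X ⊥⊆X e Xe (lookup-⊥ e))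
  where
  ⊥⊆X : ⊥ ⊆ᵇ X
  ⊥⊆X e' ⊥e' = ⊥-elim (true≢false (trans (sym ⊥e') (lookup-⊥ e')))

⊆ᵇ∧∣Y∣≤∣X∣⇒≡ : ∀ (X Y : Subset d) → X ⊆ᵇ Y → ∣ Y ∣ ≤ ∣ X ∣ → X ≡ Y
⊆ᵇ∧∣Y∣≤∣X∣⇒≡ X Y X⊆Y ∣Y∣≤∣X∣ = subset-ext pointwise
  where
  pointwise : ∀ e → lookup X e ≡ lookup Y e
  pointwise e with lookup X e in Xe | lookup Y e in Ye
  ... | true  | _     = trans (sym (X⊆Y e Xe)) Ye
  ... | false | false = refl
  ... | false | true  = ⊥-elim (<⇒≱ (⊆ᵇ⇒∣X∣<∣Y∣ X Y X⊆Y e Ye Xe) ∣Y∣≤∣X∣)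

⊆ᵇ⇒∣X⊕Y∣+∣Y∣≡∣X∣ : ∀ (X Y : Subset d) → Y ⊆ᵇ X → ∣ X ⊕ Y ∣ + ∣ Y ∣ ≡ ∣ X ∣
⊆ᵇ⇒∣X⊕Y∣+∣Y∣≡∣X∣ X Y Y⊆X = begin
  ∣ X ⊕ Y ∣ + ∣ Y ∣  ≡⟨ Disjoint⇒∣X⊕Y∣≡∣X∣+∣Y∣ (X ⊕ Y) Y X⊕Y#Y ⟨
  ∣ (X ⊕ Y) ⊕ Y ∣    ≡⟨ cong ∣_∣ (⊕-cancelʳ X Y) ⟩
  ∣ X ∣              ∎
  where
  open ≡-Reasoning
  X⊕Y#Y : Disjoint (X ⊕ Y) Y
  X⊕Y#Y e X⊕Ye with lookup Y e in Ye
  ... | false = refl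
  ... | true  = ⊥-elim (true≢false (trans (sym X⊕Ye) (trans (lookup-⊕ X Y e) (cong₂ _xor_ (Y⊆X e Ye) Ye))))

-- Linear combinations

ifᵇ : Bool → Subset d → Subset d
ifᵇ b X = if b then X else ⊥

ifᵇ-xor : ∀ b c (X : Subset d) → ifᵇ (b xor c) X ≡ ifᵇ b X ⊕ ifᵇ c X
ifᵇ-xor true  true  X = sym (⊕-self X)
ifᵇ-xor true  false X = sym (⊕-identityʳ X)
ifᵇ-xor false c     X = sym (⊕-identityˡ (ifᵇ c X))

lincomb-⊕ : ∀ (B : Fin k → Subset d) c c' → lincomb B (c ⊕ c') ≡ lincomb B c ⊕ lincomb B c'
lincomb-⊕ {zero}  B []      []        = sym (⊕-self ⊥)
lincomb-⊕ {suc k} B (b ∷ c) (b' ∷ c') =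
  trans (cong₂ _⊕_ (ifᵇ-xor b b' (B zero)) (lincomb-⊕ (B ∘ suc) c c')) (⊕-interchange _ _ _ _)

lincomb-⊥ : ∀ (B : Fin k → Subset d) → lincomb B ⊥ ≡ ⊥
lincomb-⊥ {zero}  B = refl
lincomb-⊥ {suc k} B = trans (⊕-identityˡ _) (lincomb-⊥ (B ∘ suc))

lincomb-⁅⁆ : ∀ (B : Fin k → Subset d) l → lincomb B ⁅ l ⁆ ≡ B l
lincomb-⁅⁆ {suc k} B zero    = trans (cong (B zero ⊕_) (lincomb-⊥ (B ∘ suc))) (⊕-identityʳ (B zero))
lincomb-⁅⁆ {suc k} B (suc l) = trans (⊕-identityˡ _) (lincomb-⁅⁆ (B ∘ suc) l)

lincomb-replaceAt : ∀ (B : Fin k → Subset d) l X c →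
                    lincomb (replaceAt B l X) c ≡ lincomb B c ⊕ ifᵇ (lookup c l) (B l ⊕ X)
lincomb-replaceAt {suc k} B zero X (true ∷ c) = begin
  X ⊕ L                       ≡⟨ ⊕-comm X L ⟩
  L ⊕ X                       ≡⟨ ⊕-identityˡ (L ⊕ X) ⟨
  ⊥ ⊕ (L ⊕ X)                 ≡⟨ cong (_⊕ (L ⊕ X)) (⊕-self (B zero)) ⟨
  (B zero ⊕ B zero) ⊕ (L ⊕ X) ≡⟨ ⊕-interchange (B zero) (B zero) L X ⟩
  (B zero ⊕ L) ⊕ (B zero ⊕ X) ∎
  where
  open ≡-Reasoning
  L = lincomb (B ∘ suc) c
lincomb-replaceAt {suc k} B zero X (false ∷ c) = sym (⊕-identityʳ (⊥ ⊕ lincomb (B ∘ suc) c))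
lincomb-replaceAt {suc k} B (suc l) X (b ∷ c) = begin
  ifᵇ b (B zero) ⊕ lincomb (replaceAt B (suc l) X ∘ suc) c
    ≡⟨ cong (ifᵇ b (B zero) ⊕_) (lincomb-replaceAt (B ∘ suc) l X c) ⟩
  ifᵇ b (B zero) ⊕ (lincomb (B ∘ suc) c ⊕ ifᵇ (lookup c l) (B (suc l) ⊕ X))
    ≡⟨ ⊕-assoc (ifᵇ b (B zero)) _ _ ⟨
  (ifᵇ b (B zero) ⊕ lincomb (B ∘ suc) c) ⊕ ifᵇ (lookup c l) (B (suc l) ⊕ X) ∎
  where open ≡-Reasoning

∑-update : ∀ {f g : Fin k → ℕ} l → (∀ l' → l' ≢ l → f l' ≡ g l') → ∑ f + g l ≡ ∑ g + f l
∑-update {suc k} {f} {g} zero f≗g = begin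
  ∑ f + g zero                        ≡⟨ cong (_+ g zero) (∑-suc f) ⟩
  f zero + ∑ (f ∘ suc) + g zero       ≡⟨ cong (λ t → f zero + t + g zero) (∑-cong (λ l' → f≗g (suc l') λ ())) ⟩
  f zero + ∑ (g ∘ suc) + g zero       ≡⟨ +-assoc (f zero) _ _ ⟩
  f zero + (∑ (g ∘ suc) + g zero)     ≡⟨ +-comm (f zero) _ ⟩
  ∑ (g ∘ suc) + g zero + f zero       ≡⟨ cong (_+ f zero) (+-comm (∑ (g ∘ suc)) (g zero)) ⟩
  g zero + ∑ (g ∘ suc) + f zero       ≡⟨ cong (_+ f zero) (∑-suc g) ⟨
  ∑ g + f zero                        ∎
  where open ≡-Reasoning
∑-update {suc k} {f} {g} (suc l) f≗g = begin
  ∑ f + g (suc l)                     ≡⟨ cong (_+ g (suc l)) (∑-suc f) ⟩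
  f zero + ∑ (f ∘ suc) + g (suc l)    ≡⟨ +-assoc (f zero) _ _ ⟩
  f zero + (∑ (f ∘ suc) + g (suc l))  ≡⟨ cong₂ _+_ (f≗g zero λ ()) (∑-update l λ l' → f≗g (suc l') ∘ (_∘ suc-injective)) ⟩
  g zero + (∑ (g ∘ suc) + f (suc l))  ≡⟨ +-assoc (g zero) _ _ ⟨
  g zero + ∑ (g ∘ suc) + f (suc l)    ≡⟨ cong (_+ f (suc l)) (∑-suc g) ⟨
  ∑ g + f (suc l)                     ∎
  where open ≡-Reasoning

-- If lincomb B a ≡ X with a l ≡ true, coordinates with respect to replaceAt B l X are obtained
-- from coordinates with respect to B by the involution `exchange`.
module Exchange (B : Fin k → Subset d) (l : Fin k) (X : Subset d) (a : Vec Bool k)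
                (Ba≡X : lincomb B a ≡ X) (a-l : lookup a l ≡ true) where
  open ≡-Reasoning

  private
    t : Vec Bool k
    t = ⁅ l ⁆ ⊕ a

    lincomb-t : lincomb B t ≡ B l ⊕ X
    lincomb-t = trans (lincomb-⊕ B ⁅ l ⁆ a) (cong₂ _⊕_ (lincomb-⁅⁆ B l) Ba≡X)

    lookup-ifᵇ-t : ∀ b → lookup (ifᵇ b t) l ≡ false
    lookup-ifᵇ-t true  = trans (lookup-⁅⁆⊕-same l a) (cong not a-l)
    lookup-ifᵇ-t false = lookup-⊥ l

  exchange : Vec Bool k → Vec Bool k
  exchange c = c ⊕ ifᵇ (lookup c l) t

  lookup-exchange : ∀ c → lookup (exchange c) l ≡ lookup c l
  lookup-exchange c = begin
    lookup (c ⊕ ifᵇ (lookup c l) t) l               ≡⟨ lookup-⊕ c _ l ⟩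
    lookup c l xor lookup (ifᵇ (lookup c l) t) l    ≡⟨ cong (lookup c l xor_) (lookup-ifᵇ-t (lookup c l)) ⟩
    lookup c l xor false                            ≡⟨ xor-identityʳ (lookup c l) ⟩
    lookup c l                                      ∎

  exchange-⊥ : exchange ⊥ ≡ ⊥
  exchange-⊥ = trans (cong (λ b → ⊥ ⊕ ifᵇ b t) (lookup-⊥ l)) (⊕-self ⊥)

  exchange-involutive : ∀ c → exchange (exchange c) ≡ c
  exchange-involutive c = begin
    exchange c ⊕ ifᵇ (lookup (exchange c) l) t ≡⟨ cong (λ b → exchange c ⊕ ifᵇ b t) (lookup-exchange c) ⟩
    (c ⊕ ifᵇ (lookup c l) t) ⊕ ifᵇ (lookup c l) t ≡⟨ ⊕-cancelʳ c _ ⟩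
    c                                          ∎

  lincomb-replaceAt-exchange : ∀ c → lincomb (replaceAt B l X) c ≡ lincomb B (exchange c)
  lincomb-replaceAt-exchange c = begin
    lincomb (replaceAt B l X) c                        ≡⟨ lincomb-replaceAt B l X c ⟩
    lincomb B c ⊕ ifᵇ (lookup c l) (B l ⊕ X)           ≡⟨ cong (lincomb B c ⊕_) (lincomb-ifᵇ (lookup c l)) ⟨
    lincomb B c ⊕ lincomb B (ifᵇ (lookup c l) t)       ≡⟨ lincomb-⊕ B c _ ⟨
    lincomb B (exchange c)                             ∎
    where
    lincomb-ifᵇ : ∀ b → lincomb B (ifᵇ b t) ≡ ifᵇ b (B l ⊕ X)
    lincomb-ifᵇ true  = lincomb-t
    lincomb-ifᵇ false = lincomb-⊥ B

-- Degrees, cycles and walks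

module Edges (G : Graph) where
  open Graph G

  Joins-sym : ∀ {f x y} → Joins f x y → Joins f y x
  Joins-sym (inj₁ p) = inj₂ p
  Joins-sym (inj₂ p) = inj₁ p

  Joins⇒≢ : ∀ {f x y} → Joins f x y → x ≢ y
  Joins⇒≢ {f} (inj₁ p) refl = loopless f (trans (cong proj₁ p) (sym (cong proj₂ p)))
  Joins⇒≢ {f} (inj₂ p) refl = loopless f (trans (cong proj₁ p) (sym (cong proj₂ p)))

  Joins⇒Incidentˡ : ∀ {f x y} → Joins f x y → Incident x f
  Joins⇒Incidentˡ (inj₁ p) = inj₁ (cong proj₁ p)
  Joins⇒Incidentˡ (inj₂ p) = inj₂ (cong proj₂ p)

  Joins⇒Incidentʳ : ∀ {f x y} → Joins f x y → Incident y f
  Joins⇒Incidentʳ f:xy = Joins⇒Incidentˡ (Joins-sym f:xy)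

  Incident⇒Joins : ∀ {f v} → Incident v f → ∃[ w ] Joins f v w
  Incident⇒Joins {f} (inj₁ p) = proj₂ (ends f) , inj₁ (cong (_, proj₂ (ends f)) p)
  Incident⇒Joins {f} (inj₂ p) = proj₁ (ends f) , inj₂ (cong (proj₁ (ends f) ,_) p)

  Joins∧Incident⇒≡ : ∀ {f x y v} → Joins f x y → Incident v f → v ≡ x ⊎ v ≡ y
  Joins∧Incident⇒≡ (inj₁ p) (inj₁ q) = inj₁ (trans (sym q) (cong proj₁ p))
  Joins∧Incident⇒≡ (inj₁ p) (inj₂ q) = inj₂ (trans (sym q) (cong proj₂ p))
  Joins∧Incident⇒≡ (inj₂ p) (inj₁ q) = inj₂ (trans (sym q) (cong proj₁ p))
  Joins∧Incident⇒≡ (inj₂ p) (inj₂ q) = inj₁ (trans (sym q) (cong proj₂ p))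

  incident?⇒Incident : ∀ {f v} → incident? v f ≡ true → Incident v f
  incident?⇒Incident {f} {v} p with proj₁ (ends f) ≟ v | proj₂ (ends f) ≟ v
  ... | yes q | _     = inj₁ q
  ... | no _  | yes q = inj₂ q

  _∈V?_ : ∀ v X → Dec (v ∈V X)
  v ∈V? X = any? λ e → (e ∈? X) ×-dec ((proj₁ (ends e) ≟ v) ⊎-dec (proj₂ (ends e) ≟ v))

  _≡ᵇ_ : Fin n → Fin n → Bool
  x ≡ᵇ v = does (x ≟ v)

  incident?-Joins : ∀ {f x y} v → Joins f x y → incident? v f ≡ (x ≡ᵇ v) xor (y ≡ᵇ v)
  incident?-Joins {f} v (inj₁ p) rewrite p = ∨≡xor (Joins⇒≢ (inj₁ p))
    where
    ∨≡xor : ∀ {a b} → a ≢ b → (a ≡ᵇ v) ∨ (b ≡ᵇ v) ≡ (a ≡ᵇ v) xor (b ≡ᵇ v)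
    ∨≡xor {a} {b} a≢b with a ≟ v | b ≟ v
    ... | yes refl | yes refl = ⊥-elim (a≢b refl)
    ... | yes _    | no _     = refl
    ... | no _     | _        = refl
  incident?-Joins {f} {x} {y} v (inj₂ p) =
    trans (incident?-Joins v (Joins-sym (inj₂ p))) (xor-comm (y ≡ᵇ v) (x ≡ᵇ v))

module CycleParity (G : Graph) where
  open Graph G
  open Edges G
  open ≡-Reasoning

  oddDeg : EdgeSet → Fin n → Bool
  oddDeg X v = xorSum (λ e → lookup X e ∧ incident? v e)

  odd-deg : ∀ X v → odd (deg X v) ≡ oddDeg X v
  odd-deg X v = trans (odd-∑ {m} _) (xorSum-cong {m} λ e → odd-indicator (lookup X e ∧ incident? v e))
    where
    odd-indicator : ∀ b → odd (if b then 1 else 0) ≡ b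
    odd-indicator true  = refl
    odd-indicator false = refl

  IsCycle⇒¬oddDeg : ∀ X → IsCycle X → ∀ v → oddDeg X v ≡ false
  IsCycle⇒¬oddDeg X X-cycle v = trans (sym (odd-deg X v)) (2∣⇒¬odd (X-cycle v))

  ¬oddDeg⇒IsCycle : ∀ X → (∀ v → oddDeg X v ≡ false) → IsCycle X
  ¬oddDeg⇒IsCycle X even v = ¬odd⇒2∣ (deg X v) (trans (odd-deg X v) (even v))

  oddDeg-⊕ : ∀ X Y v → oddDeg (X ⊕ Y) v ≡ oddDeg X v xor oddDeg Y v
  oddDeg-⊕ X Y v = trans (xorSum-cong {m} distrib) (xorSum-xor {m} _ _)
    where
    distrib : ∀ e → lookup (X ⊕ Y) e ∧ incident? v e ≡ (lookup X e ∧ incident? v e) xor (lookup Y e ∧ incident? v e)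
    distrib e = trans (cong (_∧ incident? v e) (lookup-⊕ X Y e)) (∧-distribʳ-xor (incident? v e) (lookup X e) (lookup Y e))

  oddDeg-⊥ : ∀ v → oddDeg ⊥ v ≡ false
  oddDeg-⊥ v = xorSum-false {m} _ (λ e → cong (_∧ incident? v e) (lookup-⊥ e))

  oddDeg-⁅⁆ : ∀ {f x y} v → Joins f x y → oddDeg ⁅ f ⁆ v ≡ (x ≡ᵇ v) xor (y ≡ᵇ v)
  oddDeg-⁅⁆ {f} {x} {y} v f:xy = begin
    oddDeg ⁅ f ⁆ v                               ≡⟨ xorSum-cong {m} (λ e → cong (_∧ incident? v e) (lookup-⁅⁆ f e)) ⟩
    xorSum (λ e → does (f ≟ e) ∧ incident? v e) ≡⟨ xorSum-⁅⁆ f (incident? v) ⟩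
    incident? v f                                ≡⟨ incident?-Joins v f:xy ⟩
    (x ≡ᵇ v) xor (y ≡ᵇ v)                        ∎

  IsCycle-⊕ : ∀ X Y → IsCycle X → IsCycle Y → IsCycle (X ⊕ Y)
  IsCycle-⊕ X Y X-cycle Y-cycle = ¬oddDeg⇒IsCycle (X ⊕ Y) λ v →
    trans (oddDeg-⊕ X Y v) (cong₂ _xor_ (IsCycle⇒¬oddDeg X X-cycle v) (IsCycle⇒¬oddDeg Y Y-cycle v))

  oddDeg⇒incident : ∀ X v → oddDeg X v ≡ true → ∃[ f ] (lookup X f ≡ true × Incident v f)
  oddDeg⇒incident X v odd with xorSum≡true⇒∃ {m} _ odd
  ... | f , Xf∧inc = f , ∧-conicalˡ _ _ Xf∧inc , incident?⇒Incident (∧-conicalʳ _ _ Xf∧inc)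

module Walks (G : Graph) where
  open Graph G
  open Edges G
  open CycleParity G
  open ≡-Reasoning

  infixr 5 _∷⟨_⟩_ _++_
  infix 4 _∈ᵥ_ _∈ₑ_ _⊆ᵉ_

  data Walk : Fin n → Fin n → Set where
    []     : ∀ {x} → Walk x x
    _∷⟨_⟩_ : ∀ {x y z} (f : Fin m) → Joins f x y → Walk y z → Walk x z

  private
    variable
      x y z v : Fin n
      g : Fin m

  _∈ᵥ_ : Fin n → Walk x y → Set
  v ∈ᵥ [] {x}           = v ≡ x
  v ∈ᵥ _∷⟨_⟩_ {x} _ _ w = v ≡ x ⊎ v ∈ᵥ w

  _∈ₑ_ : Fin m → Walk x y → Set
  g ∈ₑ []         = Empty
  g ∈ₑ f ∷⟨ _ ⟩ w = g ≡ f ⊎ g ∈ₑ w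

  IsPath : Walk x y → Set
  IsPath []                 = ⊤
  IsPath (_∷⟨_⟩_ {x} _ _ w) = ¬ x ∈ᵥ w × IsPath w

  edges : Walk x y → EdgeSet
  edges []           = ⊥
  edges (f ∷⟨ _ ⟩ w) = ⁅ f ⁆ ⊕ edges w

  _⊆ᵉ_ : Walk x y → EdgeSet → Set
  w ⊆ᵉ W = ∀ g → g ∈ₑ w → lookup W g ≡ true

  _++_ : Walk x y → Walk y z → Walk x z
  []           ++ w' = w'
  (f ∷⟨ j ⟩ w) ++ w' = f ∷⟨ j ⟩ (w ++ w')

  first∈ᵥ : ∀ (w : Walk x y) → x ∈ᵥ w
  first∈ᵥ []           = refl
  first∈ᵥ (_ ∷⟨ _ ⟩ _) = inj₁ refl

  last∈ᵥ : ∀ (w : Walk x y) → y ∈ᵥ w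
  last∈ᵥ []           = refl
  last∈ᵥ (_ ∷⟨ _ ⟩ w) = inj₂ (last∈ᵥ w)

  ∈ᵥ-++⁻ : ∀ (w : Walk x y) (w' : Walk y z) → v ∈ᵥ w ++ w' → v ∈ᵥ w ⊎ v ∈ᵥ w'
  ∈ᵥ-++⁻ []           w' p        = inj₂ p
  ∈ᵥ-++⁻ (_ ∷⟨ _ ⟩ w) w' (inj₁ p) = inj₁ (inj₁ p)
  ∈ᵥ-++⁻ (_ ∷⟨ _ ⟩ w) w' (inj₂ p) with ∈ᵥ-++⁻ w w' p
  ... | inj₁ q = inj₁ (inj₂ q)
  ... | inj₂ q = inj₂ q

  ∈ᵥ-++⁺ˡ : ∀ (w : Walk x y) (w' : Walk y z) → v ∈ᵥ w → v ∈ᵥ w ++ w'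
  ∈ᵥ-++⁺ˡ []           w' refl     = first∈ᵥ w'
  ∈ᵥ-++⁺ˡ (_ ∷⟨ _ ⟩ w) w' (inj₁ p) = inj₁ p
  ∈ᵥ-++⁺ˡ (_ ∷⟨ _ ⟩ w) w' (inj₂ p) = inj₂ (∈ᵥ-++⁺ˡ w w' p)

  ∈ᵥ-++⁺ʳ : ∀ (w : Walk x y) (w' : Walk y z) → v ∈ᵥ w' → v ∈ᵥ w ++ w'
  ∈ᵥ-++⁺ʳ []           w' p = p
  ∈ᵥ-++⁺ʳ (_ ∷⟨ _ ⟩ w) w' p = inj₂ (∈ᵥ-++⁺ʳ w w' p)

  ∈ₑ-++⁻ : ∀ (w : Walk x y) (w' : Walk y z) → g ∈ₑ w ++ w' → g ∈ₑ w ⊎ g ∈ₑ w'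
  ∈ₑ-++⁻ []           w' p        = inj₂ p
  ∈ₑ-++⁻ (_ ∷⟨ _ ⟩ w) w' (inj₁ p) = inj₁ (inj₁ p)
  ∈ₑ-++⁻ (_ ∷⟨ _ ⟩ w) w' (inj₂ p) with ∈ₑ-++⁻ w w' p
  ... | inj₁ q = inj₁ (inj₂ q)
  ... | inj₂ q = inj₂ q

  ∈ₑ-++⁺ˡ : ∀ (w : Walk x y) (w' : Walk y z) → g ∈ₑ w → g ∈ₑ w ++ w'
  ∈ₑ-++⁺ˡ (_ ∷⟨ _ ⟩ w) w' (inj₁ p) = inj₁ p
  ∈ₑ-++⁺ˡ (_ ∷⟨ _ ⟩ w) w' (inj₂ p) = inj₂ (∈ₑ-++⁺ˡ w w' p)

  ∈ₑ-++⁺ʳ : ∀ (w : Walk x y) (w' : Walk y z) → g ∈ₑ w' → g ∈ₑ w ++ w'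
  ∈ₑ-++⁺ʳ []           w' p = p
  ∈ₑ-++⁺ʳ (_ ∷⟨ _ ⟩ w) w' p = inj₂ (∈ₑ-++⁺ʳ w w' p)

  edges-++ : ∀ (w : Walk x y) (w' : Walk y z) → edges (w ++ w') ≡ edges w ⊕ edges w'
  edges-++ []           w' = sym (⊕-identityˡ (edges w'))
  edges-++ (f ∷⟨ _ ⟩ w) w' = trans (cong (⁅ f ⁆ ⊕_) (edges-++ w w')) (sym (⊕-assoc ⁅ f ⁆ (edges w) (edges w')))

  IsPath-++⁻ : ∀ (w : Walk x y) (w' : Walk y z) → IsPath (w ++ w') →
               IsPath w × IsPath w' × (∀ v → v ∈ᵥ w → v ∈ᵥ w' → v ≡ y)
  IsPath-++⁻ []           w' p = tt , p , λ _ v≡x _ → v≡x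
  IsPath-++⁻ {x = x} {y = y} (_ ∷⟨ _ ⟩ w) w' (x∉ , p) with IsPath-++⁻ w w' p
  ... | w-path , w'-path , meet = ((λ x∈w → x∉ (∈ᵥ-++⁺ˡ w w' x∈w)) , w-path) , w'-path , meet'
    where
    meet' : ∀ v → v ≡ x ⊎ v ∈ᵥ w → v ∈ᵥ w' → v ≡ y
    meet' v (inj₁ refl) v∈w' = ⊥-elim (x∉ (∈ᵥ-++⁺ʳ w w' v∈w'))
    meet' v (inj₂ v∈w)  v∈w' = meet v v∈w v∈w'

  ∈ₑ⇒Joins : ∀ (w : Walk x y) → g ∈ₑ w → ∃[ a ] ∃[ b ] (Joins g a b × a ∈ᵥ w × b ∈ᵥ w)
  ∈ₑ⇒Joins (_ ∷⟨ j ⟩ w) (inj₁ refl) = _ , _ , j , inj₁ refl , inj₂ (first∈ᵥ w)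
  ∈ₑ⇒Joins (_ ∷⟨ _ ⟩ w) (inj₂ p) with ∈ₑ⇒Joins w p
  ... | a , b , j , a∈w , b∈w = a , b , j , inj₂ a∈w , inj₂ b∈w

  ∈ₑ∧Incident⇒∈ᵥ : ∀ (w : Walk x y) → g ∈ₑ w → Incident v g → v ∈ᵥ w
  ∈ₑ∧Incident⇒∈ᵥ w g∈w v~g with ∈ₑ⇒Joins w g∈w
  ... | a , b , j , a∈w , b∈w with Joins∧Incident⇒≡ j v~g
  ...   | inj₁ refl = a∈w
  ...   | inj₂ refl = b∈w

  incidentEdge : ∀ f (j : Joins f x y) (w : Walk y z) → v ∈ᵥ f ∷⟨ j ⟩ w → ∃[ g ] (g ∈ₑ f ∷⟨ j ⟩ w × Incident v g)
  incidentEdge f j w              (inj₁ refl) = f , inj₁ refl , Joins⇒Incidentˡ j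
  incidentEdge f j []             (inj₂ refl) = f , inj₁ refl , Joins⇒Incidentʳ j
  incidentEdge f j (f' ∷⟨ j' ⟩ w) (inj₂ p) with incidentEdge f' j' w p
  ... | g , g∈w , v~g = g , inj₂ g∈w , v~g

  nonempty⇒incidentEdge : ∀ (w : Walk x y) → x ≢ y → v ∈ᵥ w → ∃[ g ] (g ∈ₑ w × Incident v g)
  nonempty⇒incidentEdge []           x≢x _   = ⊥-elim (x≢x refl)
  nonempty⇒incidentEdge (f ∷⟨ j ⟩ w) _   v∈w = incidentEdge f j w v∈w

  edges⇒∈ₑ : ∀ (w : Walk x y) → lookup (edges w) g ≡ true → g ∈ₑ w
  edges⇒∈ₑ {g = g} [] p = ⊥-elim (true≢false (trans (sym p) (lookup-⊥ g)))
  edges⇒∈ₑ {g = g} (f ∷⟨ _ ⟩ w) p with f ≟ g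
  ... | yes refl = inj₁ refl
  ... | no f≢g   = inj₂ (edges⇒∈ₑ w (trans (sym (lookup-⁅⁆⊕-≢ (edges w) f≢g)) p))

  ∉ₑ⇒edges : ∀ (w : Walk x y) → ¬ g ∈ₑ w → lookup (edges w) g ≡ false
  ∉ₑ⇒edges {g = g} w g∉w with lookup (edges w) g in p
  ... | true  = ⊥-elim (g∉w (edges⇒∈ₑ w p))
  ... | false = refl

  IsPath∧∈ₑ⇒edges : ∀ (w : Walk x y) → IsPath w → g ∈ₑ w → lookup (edges w) g ≡ true
  IsPath∧∈ₑ⇒edges {g = g} (_∷⟨_⟩_ {x} f j w) (x∉w , w-path) g∈ with f ≟ g
  ... | yes refl = trans (lookup-⁅⁆⊕-same f (edges w)) (cong not (∉ₑ⇒edges w f∉w))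
    where
    f∉w : ¬ f ∈ₑ w
    f∉w f∈w = x∉w (∈ₑ∧Incident⇒∈ᵥ w f∈w (Joins⇒Incidentˡ j))
  ... | no f≢g with g∈
  ...   | inj₁ refl = ⊥-elim (f≢g refl)
  ...   | inj₂ g∈w  = trans (lookup-⁅⁆⊕-≢ (edges w) f≢g) (IsPath∧∈ₑ⇒edges w w-path g∈w)

  ⊆ᵉ⇒edges⊆ᵇ : ∀ {W} (w : Walk x y) → w ⊆ᵉ W → edges w ⊆ᵇ W
  ⊆ᵉ⇒edges⊆ᵇ w w⊆W g p = w⊆W g (edges⇒∈ₑ w p)

  oddDeg-edges : ∀ (w : Walk x y) v → oddDeg (edges w) v ≡ (x ≡ᵇ v) xor (y ≡ᵇ v)
  oddDeg-edges {x} [] v = trans (oddDeg-⊥ v) (sym (xor-same (x ≡ᵇ v)))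
  oddDeg-edges {x} {z} (_∷⟨_⟩_ {y = y} f j w) v = begin
    oddDeg (⁅ f ⁆ ⊕ edges w) v                        ≡⟨ oddDeg-⊕ ⁅ f ⁆ (edges w) v ⟩
    oddDeg ⁅ f ⁆ v xor oddDeg (edges w) v             ≡⟨ cong₂ _xor_ (oddDeg-⁅⁆ v j) (oddDeg-edges w v) ⟩
    ((x ≡ᵇ v) xor (y ≡ᵇ v)) xor ((y ≡ᵇ v) xor (z ≡ᵇ v)) ≡⟨ xor-telescope (x ≡ᵇ v) (y ≡ᵇ v) (z ≡ᵇ v) ⟩
    (x ≡ᵇ v) xor (z ≡ᵇ v)                             ∎

  _∈ᵥ?_ : ∀ v (w : Walk x y) → Dec (v ∈ᵥ w)
  v ∈ᵥ? []           = v ≟ _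
  v ∈ᵥ? (_ ∷⟨ _ ⟩ w) = (v ≟ _) ⊎-dec (v ∈ᵥ? w)

  record FirstHit (P : Fin n → Set) (w : Walk x y) : Set where
    field
      {hit}  : Fin n
      P-hit  : P hit
      before : Walk x hit
      after  : Walk hit y
      split  : w ≡ before ++ after
      first  : ∀ v → v ∈ᵥ before → P v → v ≡ hit

  record LastHit (P : Fin n → Set) (w : Walk x y) : Set where
    field
      {hit}  : Fin n
      P-hit  : P hit
      before : Walk x hit
      after  : Walk hit y
      split  : w ≡ before ++ after
      last   : ∀ v → v ∈ᵥ after → P v → v ≡ hit

  Avoids : (Fin n → Set) → Walk x y → Set
  Avoids P w = ∀ v → v ∈ᵥ w → ¬ P v

  firstHit : ∀ {P} → Decidable P → (w : Walk x y) → Avoids P w ⊎ FirstHit P w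
  firstHit P? ([] {x}) with P? x
  ... | yes Px = inj₂ (record { P-hit = Px ; before = [] ; after = [] ; split = refl ; first = λ _ v≡x _ → v≡x })
  ... | no ¬Px = inj₁ λ { _ refl → ¬Px }
  firstHit P? (_∷⟨_⟩_ {x} f j w) with P? x
  ... | yes Px = inj₂ (record { P-hit = Px ; before = [] ; after = f ∷⟨ j ⟩ w ; split = refl ; first = λ _ v≡x _ → v≡x })
  ... | no ¬Px with firstHit P? w
  ...   | inj₁ avoids = inj₁ λ { _ (inj₁ refl) → ¬Px ; v (inj₂ v∈w) → avoids v v∈w }
  ...   | inj₂ h = inj₂ (record
          { P-hit = P-hit ; before = f ∷⟨ j ⟩ before ; after = after ; split = cong (f ∷⟨ j ⟩_) split
          ; first = λ { _ (inj₁ refl) Px → ⊥-elim (¬Px Px) ; v (inj₂ v∈b) Pv → first v v∈b Pv } })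
    where open FirstHit h

  lastHit : ∀ {P} → Decidable P → (w : Walk x y) → Avoids P w ⊎ LastHit P w
  lastHit P? ([] {x}) with P? x
  ... | yes Px = inj₂ (record { P-hit = Px ; before = [] ; after = [] ; split = refl ; last = λ _ v≡x _ → v≡x })
  ... | no ¬Px = inj₁ λ { _ refl → ¬Px }
  lastHit P? (_∷⟨_⟩_ {x} f j w) with lastHit P? w
  ... | inj₂ h = inj₂ (record
        { P-hit = P-hit ; before = f ∷⟨ j ⟩ before ; after = after ; split = cong (f ∷⟨ j ⟩_) split ; last = last })
    where open LastHit h
  ... | inj₁ avoids with P? x
  ...   | yes Px = inj₂ (record
          { P-hit = Px ; before = [] ; after = f ∷⟨ j ⟩ w ; split = refl
          ; last = λ { _ (inj₁ v≡x) _ → v≡x ; v (inj₂ v∈w) Pv → ⊥-elim (avoids v v∈w Pv) } })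
  ...   | no ¬Px = inj₁ λ { _ (inj₁ refl) → ¬Px ; v (inj₂ v∈w) → avoids v v∈w }

  record Shortcut (w : Walk x y) : Set where
    field
      path    : Walk x y
      isPath  : IsPath path
      ⊆ᵥ      : ∀ v → v ∈ᵥ path → v ∈ᵥ w
      ⊆ₑ      : ∀ g → g ∈ₑ path → g ∈ₑ w

  shortcut : ∀ (w : Walk x y) → Shortcut w
  shortcut [] = record { path = [] ; isPath = tt ; ⊆ᵥ = λ _ p → p ; ⊆ₑ = λ _ () }
  shortcut (_∷⟨_⟩_ {x} f j w) with shortcut w
  ... | record { path = p ; isPath = p-path ; ⊆ᵥ = p⊆ᵥw ; ⊆ₑ = p⊆ₑw } with x ∈ᵥ? p
  ...   | no x∉p = record
          { path = f ∷⟨ j ⟩ p ; isPath = x∉p , p-path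
          ; ⊆ᵥ = λ { _ (inj₁ v≡x) → inj₁ v≡x ; v (inj₂ v∈p) → inj₂ (p⊆ᵥw v v∈p) }
          ; ⊆ₑ = λ { _ (inj₁ g≡f) → inj₁ g≡f ; g (inj₂ g∈p) → inj₂ (p⊆ₑw g g∈p) } }
  ...   | yes x∈p with firstHit (_≟ x) p
  ...     | inj₁ avoids = ⊥-elim (avoids x x∈p refl)
  ...     | inj₂ record { P-hit = refl ; before = p₁ ; after = p₂ ; split = p≡p₁++p₂ } = record
            { path = p₂ ; isPath = proj₁ (proj₂ (IsPath-++⁻ p₁ p₂ (subst IsPath p≡p₁++p₂ p-path)))
            ; ⊆ᵥ = λ v v∈p₂ → inj₂ (p⊆ᵥw v (subst (v ∈ᵥ_) (sym p≡p₁++p₂) (∈ᵥ-++⁺ʳ p₁ p₂ v∈p₂)))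
            ; ⊆ₑ = λ g g∈p₂ → inj₂ (p⊆ₑw g (subst (g ∈ₑ_) (sym p≡p₁++p₂) (∈ₑ-++⁺ʳ p₁ p₂ g∈p₂))) }

  oddEnds⇒walk : ∀ Y {c a} → (∀ v → oddDeg Y v ≡ (c ≡ᵇ v) xor (a ≡ᵇ v)) → Σ (Walk c a) (_⊆ᵉ Y)
  oddEnds⇒walk Y = go Y (<-wellFounded ∣ Y ∣)
    where
    go : ∀ Y {c a} → Acc _<_ ∣ Y ∣ → (∀ v → oddDeg Y v ≡ (c ≡ᵇ v) xor (a ≡ᵇ v)) → Σ (Walk c a) (_⊆ᵉ Y)
    go Y {c} {a} (acc smaller) ends with c ≟ a
    ... | yes refl = [] , λ _ ()
    ... | no c≢a   = extend (oddDeg⇒incident Y c c-odd)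
      where
      c-odd : oddDeg Y c ≡ true
      c-odd = trans (ends c) (cong₂ _xor_ (dec-true (c ≟ c) refl) (dec-false (a ≟ c) (c≢a ∘ sym)))

      extend : ∃[ f ] (lookup Y f ≡ true × Incident c f) → Σ (Walk c a) (_⊆ᵉ Y)
      extend (f , Yf , c~f) = f ∷⟨ f:cc' ⟩ w , λ { _ (inj₁ refl) → Yf ; g (inj₂ g∈w) → Y-f⊆Y g (w⊆Y-f g g∈w) }
        where
        c'    = proj₁ (Incident⇒Joins c~f)
        f:cc' = proj₂ (Incident⇒Joins c~f)
        Y-f⊆Y : (⁅ f ⁆ ⊕ Y) ⊆ᵇ Y
        Y-f⊆Y = ⊕-⊆ᵇ ⁅ f ⁆ Y Y (⁅⁆⊆ᵇ Y Yf) (λ _ Ye → Ye)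
        ∣Y-f∣<∣Y∣ : ∣ ⁅ f ⁆ ⊕ Y ∣ < ∣ Y ∣
        ∣Y-f∣<∣Y∣ = ⊆ᵇ⇒∣X∣<∣Y∣ (⁅ f ⁆ ⊕ Y) Y Y-f⊆Y f Yf (trans (lookup-⁅⁆⊕-same f Y) (cong not Yf))
        ends' : ∀ v → oddDeg (⁅ f ⁆ ⊕ Y) v ≡ (c' ≡ᵇ v) xor (a ≡ᵇ v)
        ends' v = begin
          oddDeg (⁅ f ⁆ ⊕ Y) v                                ≡⟨ oddDeg-⊕ ⁅ f ⁆ Y v ⟩
          oddDeg ⁅ f ⁆ v xor oddDeg Y v                       ≡⟨ cong₂ _xor_ (oddDeg-⁅⁆ v f:cc') (ends v) ⟩
          ((c ≡ᵇ v) xor (c' ≡ᵇ v)) xor ((c ≡ᵇ v) xor (a ≡ᵇ v)) ≡⟨ xor-cancelˡ-shared (c ≡ᵇ v) _ _ ⟩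
          (c' ≡ᵇ v) xor (a ≡ᵇ v)                              ∎
        w⁺    = go (⁅ f ⁆ ⊕ Y) (smaller ∣Y-f∣<∣Y∣) ends'
        w     = proj₁ w⁺
        w⊆Y-f = proj₂ w⁺

  meetsOnce⇒noEdgeIn : ∀ {X z} (w : Walk x y) → (∀ v → v ∈ᵥ w → v ∈V X → v ≡ z) →
                       ∀ g → g ∈ₑ w → lookup X g ≡ false
  meetsOnce⇒noEdgeIn {X = X} w once g g∈w with lookup X g in Xg
  ... | false = refl
  ... | true with ∈ₑ⇒Joins w g∈w
  ...   | p , q , g:pq , p∈w , q∈w = ⊥-elim (Joins⇒≢ g:pq (trans (once p p∈w p∈X) (sym (once q q∈w q∈X))))
    where
    p∈X = g , lookup⇒[]= g X Xg , Joins⇒Incidentˡ g:pq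
    q∈X = g , lookup⇒[]= g X Xg , Joins⇒Incidentʳ g:pq

  closedPath⇒∈ᵥ⇒≡ : ∀ (w : Walk x y) → x ≡ y → IsPath w → v ∈ᵥ w → v ≡ x
  closedPath⇒∈ᵥ⇒≡ []           _   _          v∈w = v∈w
  closedPath⇒∈ᵥ⇒≡ (_ ∷⟨ _ ⟩ w) x≡y (x∉w , _) _   = ⊥-elim (x∉w (subst (_∈ᵥ w) (sym x≡y) (last∈ᵥ w)))

  sameEnds⇒IsCycle : ∀ {x' y'} (w : Walk x y) (w' : Walk x' y') →
                     (∀ v → (x ≡ᵇ v) xor (y ≡ᵇ v) ≡ (x' ≡ᵇ v) xor (y' ≡ᵇ v)) → IsCycle (edges w ⊕ edges w')
  sameEnds⇒IsCycle {x} {y} {x'} {y'} w w' same = ¬oddDeg⇒IsCycle (edges w ⊕ edges w') λ v → begin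
    oddDeg (edges w ⊕ edges w') v                  ≡⟨ oddDeg-⊕ (edges w) (edges w') v ⟩
    oddDeg (edges w) v xor oddDeg (edges w') v     ≡⟨ cong₂ _xor_ (trans (oddDeg-edges w v) (same v)) (oddDeg-edges w' v) ⟩
    ((x' ≡ᵇ v) xor (y' ≡ᵇ v)) xor ((x' ≡ᵇ v) xor (y' ≡ᵇ v)) ≡⟨ xor-same ((x' ≡ᵇ v) xor (y' ≡ᵇ v)) ⟩
    false                                          ∎

  length : Walk x y → ℕ
  length []           = 0
  length (_ ∷⟨ _ ⟩ w) = suc (length w)

  vertexAt : ∀ (w : Walk x y) → Fin (suc (length w)) → Fin n
  vertexAt ([] {x})          zero    = x
  vertexAt (_∷⟨_⟩_ {x} _ _ _) zero    = x
  vertexAt (_ ∷⟨ _ ⟩ w)       (suc i) = vertexAt w i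

  edgeAt : ∀ (w : Walk x y) → Fin (length w) → Fin m
  edgeAt (f ∷⟨ _ ⟩ _) zero    = f
  edgeAt (_ ∷⟨ _ ⟩ w) (suc i) = edgeAt w i

  edgeAt-Joins : ∀ (w : Walk x y) i → Joins (edgeAt w i) (vertexAt w (inject₁ i)) (vertexAt w (suc i))
  edgeAt-Joins (_ ∷⟨ j ⟩ [])           zero    = j
  edgeAt-Joins (_ ∷⟨ j ⟩ (_ ∷⟨ _ ⟩ _)) zero    = j
  edgeAt-Joins (_ ∷⟨ _ ⟩ w)            (suc i) = edgeAt-Joins w i

  ∈ᵥ⇔vertexAt : ∀ (w : Walk x y) → v ∈ᵥ w ⇔ (∃[ i ] vertexAt w i ≡ v)
  ∈ᵥ⇔vertexAt w = mk⇔ (to w) (from w)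
    where
    to : ∀ {x y} (w : Walk x y) → v ∈ᵥ w → ∃[ i ] vertexAt w i ≡ v
    to []           refl        = zero , refl
    to (_ ∷⟨ _ ⟩ w) (inj₁ refl) = zero , refl
    to (_ ∷⟨ _ ⟩ w) (inj₂ v∈w)  = let i , eq = to w v∈w in suc i , eq
    from : ∀ {x y} (w : Walk x y) → ∃[ i ] vertexAt w i ≡ v → v ∈ᵥ w
    from []           (zero , refl) = refl
    from (_ ∷⟨ _ ⟩ w) (zero , refl) = inj₁ refl
    from (_ ∷⟨ _ ⟩ w) (suc i , eq)  = inj₂ (from w (i , eq))

  ∈ₑ⇔edgeAt : ∀ (w : Walk x y) → g ∈ₑ w ⇔ (∃[ i ] edgeAt w i ≡ g)
  ∈ₑ⇔edgeAt w = mk⇔ (to w) (from w)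
    where
    to : ∀ {x y} (w : Walk x y) → g ∈ₑ w → ∃[ i ] edgeAt w i ≡ g
    to (_ ∷⟨ _ ⟩ w) (inj₁ refl) = zero , refl
    to (_ ∷⟨ _ ⟩ w) (inj₂ g∈w)  = let i , eq = to w g∈w in suc i , eq
    from : ∀ {x y} (w : Walk x y) → ∃[ i ] edgeAt w i ≡ g → g ∈ₑ w
    from (_ ∷⟨ _ ⟩ w) (zero , refl) = inj₁ refl
    from (_ ∷⟨ _ ⟩ w) (suc i , eq)  = inj₂ (from w (i , eq))

  IsPath⇒vertexAt-injective : ∀ (w : Walk x y) → IsPath w → ∀ {i j} → vertexAt w i ≡ vertexAt w j → i ≡ j
  IsPath⇒vertexAt-injective []           _          {zero}  {zero}  _  = refl
  IsPath⇒vertexAt-injective (_ ∷⟨ _ ⟩ w) _          {zero}  {zero}  _  = refl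
  IsPath⇒vertexAt-injective (_ ∷⟨ _ ⟩ w) (x∉w , _) {zero}  {suc j} eq =
    ⊥-elim (x∉w (Equivalence.from (∈ᵥ⇔vertexAt w) (j , sym eq)))
  IsPath⇒vertexAt-injective (_ ∷⟨ _ ⟩ w) (x∉w , _) {suc i} {zero}  eq =
    ⊥-elim (x∉w (Equivalence.from (∈ᵥ⇔vertexAt w) (i , eq)))
  IsPath⇒vertexAt-injective (_ ∷⟨ _ ⟩ w) (_ , w-path) {suc i} {suc j} eq = cong suc (IsPath⇒vertexAt-injective w w-path eq)

  IsPath⇒IntersectionIsPath : ∀ {C D} (w : Walk x y) → IsPath w →
    (∀ v → ((v ∈V C) × (v ∈V D)) ⇔ v ∈ᵥ w) → (∀ e → e ∈ C ∩ D ⇔ e ∈ₑ w) → IntersectionIsPath G C D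
  IsPath⇒IntersectionIsPath w w-path vertices edges' =
    length w , vertexAt w , edgeAt w , IsPath⇒vertexAt-injective w w-path , edgeAt-Joins w ,
    (λ v → ⇔-trans (vertices v) (∈ᵥ⇔vertexAt w)) , (λ e → ⇔-trans (edges' e) (∈ₑ⇔edgeAt w))

-- Cycle bases

module Coordinates (G : Graph) {k} (M : Fin k → Graph.EdgeSet G) (M-basis : IsCycleBasis G M) where
  open Graph G
  open CycleParity G
  open ≡-Reasoning

  M-cycle : ∀ l → IsCycle (M l)
  M-cycle = proj₁ M-basis

  lincomb-injective : ∀ c c' → lincomb M c ≡ lincomb M c' → c ≡ c'
  lincomb-injective c c' eq = ⊕≡⊥⇒≡ (proj₁ (proj₂ M-basis) (c ⊕ c') lincomb-c⊕c'≡⊥)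
    where
    lincomb-c⊕c'≡⊥ : lincomb M (c ⊕ c') ≡ ⊥
    lincomb-c⊕c'≡⊥ = trans (lincomb-⊕ M c c') (trans (cong (_⊕ lincomb M c') eq) (⊕-self _))

  coords : ∀ X → IsCycle X → Vec Bool k
  coords X X-cycle = proj₁ (proj₂ (proj₂ M-basis) X X-cycle)

  lincomb-coords : ∀ X X-cycle → lincomb M (coords X X-cycle) ≡ X
  lincomb-coords X X-cycle = proj₂ (proj₂ (proj₂ M-basis) X X-cycle)

  coord : Fin k → ∀ X → IsCycle X → Bool
  coord l X X-cycle = lookup (coords X X-cycle) l

  coord-unique : ∀ l X X-cycle c → lincomb M c ≡ X → coord l X X-cycle ≡ lookup c l
  coord-unique l X X-cycle c Mc≡X = cong (λ d → lookup d l) (lincomb-injective _ _ (trans (lincomb-coords X X-cycle) (sym Mc≡X)))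

  coord-cong : ∀ l {X Y} X-cycle Y-cycle → X ≡ Y → coord l X X-cycle ≡ coord l Y Y-cycle
  coord-cong l {X} X-cycle Y-cycle refl = sym (coord-unique l X Y-cycle _ (lincomb-coords X X-cycle))

  coord-⊕ : ∀ l X Y X-cycle Y-cycle X⊕Y-cycle → coord l (X ⊕ Y) X⊕Y-cycle ≡ coord l X X-cycle xor coord l Y Y-cycle
  coord-⊕ l X Y X-cycle Y-cycle X⊕Y-cycle = begin
    coord l (X ⊕ Y) X⊕Y-cycle                      ≡⟨ coord-unique l (X ⊕ Y) X⊕Y-cycle _ lincomb-sum ⟩
    lookup (coords X X-cycle ⊕ coords Y Y-cycle) l ≡⟨ lookup-⊕ (coords X X-cycle) _ l ⟩
    coord l X X-cycle xor coord l Y Y-cycle        ∎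
    where
    lincomb-sum : lincomb M (coords X X-cycle ⊕ coords Y Y-cycle) ≡ X ⊕ Y
    lincomb-sum = trans (lincomb-⊕ M _ _) (cong₂ _⊕_ (lincomb-coords X X-cycle) (lincomb-coords Y Y-cycle))

  coord-basis : ∀ l l' → coord l (M l') (M-cycle l') ≡ does (l' ≟ l)
  coord-basis l l' = trans (coord-unique l (M l') (M-cycle l') ⁅ l' ⁆ (lincomb-⁅⁆ M l')) (lookup-⁅⁆ l' l)

  replaceAt-IsCycleBasis : ∀ l X X-cycle → coord l X X-cycle ≡ true → IsCycleBasis G (replaceAt M l X)
  replaceAt-IsCycleBasis l X X-cycle X-l = cycles , independent , spans
    where
    open Exchange M l X (coords X X-cycle) (lincomb-coords X X-cycle) X-l

    cycles : ∀ l' → IsCycle (replaceAt M l X l')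
    cycles l' with does (l' ≟ l)
    ... | true  = X-cycle
    ... | false = M-cycle l'

    independent : ∀ c → lincomb (replaceAt M l X) c ≡ ⊥ → c ≡ ⊥
    independent c eq = begin
      c                     ≡⟨ exchange-involutive c ⟨
      exchange (exchange c) ≡⟨ cong exchange exchange-c≡⊥ ⟩
      exchange ⊥            ≡⟨ exchange-⊥ ⟩
      ⊥                     ∎
      where
      exchange-c≡⊥ : exchange c ≡ ⊥
      exchange-c≡⊥ = proj₁ (proj₂ M-basis) (exchange c) (trans (sym (lincomb-replaceAt-exchange c)) eq)

    spans : ∀ C → IsCycle C → ∃[ d ] lincomb (replaceAt M l X) d ≡ C
    spans C C-cycle = exchange (coords C C-cycle) , (begin
      lincomb (replaceAt M l X) (exchange (coords C C-cycle)) ≡⟨ lincomb-replaceAt-exchange _ ⟩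
      lincomb M (exchange (exchange (coords C C-cycle)))      ≡⟨ cong (lincomb M) (exchange-involutive _) ⟩
      lincomb M (coords C C-cycle)                            ≡⟨ lincomb-coords C C-cycle ⟩
      C                                                       ∎)

module MinimumBasis (G : Graph) {k} (M : Fin k → Graph.EdgeSet G) (M-mcb : IsMCB G M) where
  open Graph G
  open Edges G
  open CycleParity G
  open Walks G
  open Coordinates G M (proj₁ M-mcb) public

  weight-replaceAt : ∀ l X → weight G (replaceAt M l X) + ∣ M l ∣ ≡ weight G M + ∣ X ∣
  weight-replaceAt l X = begin
    weight G (replaceAt M l X) + ∣ M l ∣  ≡⟨ ∑-update l unchanged ⟩
    weight G M + ∣ replaceAt M l X l ∣    ≡⟨ cong (λ b → weight G M + ∣ (if b then X else M l) ∣) (dec-true (l ≟ l) refl) ⟩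
    weight G M + ∣ X ∣                    ∎
    where
    open ≡-Reasoning
    unchanged : ∀ l' → l' ≢ l → ∣ replaceAt M l X l' ∣ ≡ ∣ M l' ∣
    unchanged l' l'≢l = cong (λ b → ∣ (if b then X else M l') ∣) (dec-false (l' ≟ l) l'≢l)

  coord≡true⇒∣M∣≤∣X∣ : ∀ l X X-cycle → coord l X X-cycle ≡ true → ∣ M l ∣ ≤ ∣ X ∣
  coord≡true⇒∣M∣≤∣X∣ l X X-cycle X-l = +-cancelˡ-≤ (weight G M) _ _ (begin
    weight G M + ∣ M l ∣                 ≤⟨ +-monoˡ-≤ ∣ M l ∣ (proj₂ M-mcb (replaceAt M l X) exchanged-basis) ⟩
    weight G (replaceAt M l X) + ∣ M l ∣ ≡⟨ weight-replaceAt l X ⟩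
    weight G M + ∣ X ∣                   ∎)
    where
    open ≤-Reasoning
    exchanged-basis = replaceAt-IsCycleBasis l X X-cycle X-l

  record Exchangeable (l : Fin k) (X : EdgeSet) : Set where
    field
      isCycle    : IsCycle X
      coord≡true : coord l X isCycle ≡ true
      ∣X∣≤∣M∣    : ∣ X ∣ ≤ ∣ M l ∣

  M-exchangeable : ∀ l → Exchangeable l (M l)
  M-exchangeable l = record
    { isCycle = M-cycle l ; coord≡true = trans (coord-basis l l) (dec-true (l ≟ l) refl) ; ∣X∣≤∣M∣ = ≤-refl }

  Exchangeable⇒IsMCB : ∀ {l X} → Exchangeable l X → IsMCB G (replaceAt M l X)
  Exchangeable⇒IsMCB {l} {X} ex =
    replaceAt-IsCycleBasis l X isCycle coord≡true , λ B B-basis → ≤-trans lighter (proj₂ M-mcb B B-basis)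
    where
    open Exchangeable ex
    open ≤-Reasoning
    lighter : weight G (replaceAt M l X) ≤ weight G M
    lighter = +-cancelʳ-≤ ∣ M l ∣ _ _ (begin
      weight G (replaceAt M l X) + ∣ M l ∣ ≡⟨ weight-replaceAt l X ⟩
      weight G M + ∣ X ∣                   ≤⟨ +-monoʳ-≤ (weight G M) ∣X∣≤∣M∣ ⟩
      weight G M + ∣ M l ∣                 ∎)

  coord-⊕≡true⇒∣M∣≤ : ∀ l X Y X-cycle Y-cycle X⊕Y-cycle → coord l (X ⊕ Y) X⊕Y-cycle ≡ true →
                      ∣ M l ∣ ≤ ∣ X ∣ ⊎ ∣ M l ∣ ≤ ∣ Y ∣
  coord-⊕≡true⇒∣M∣≤ l X Y X-cycle Y-cycle X⊕Y-cycle X⊕Y-l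
    with xor≡true⇒⊎ (trans (sym (coord-⊕ l X Y X-cycle Y-cycle X⊕Y-cycle)) X⊕Y-l)
  ... | inj₁ X-l = inj₁ (coord≡true⇒∣M∣≤∣X∣ l X X-cycle X-l)
  ... | inj₂ Y-l = inj₂ (coord≡true⇒∣M∣≤∣X∣ l Y Y-cycle Y-l)

  ⊕≡M⇒∣M∣≤ : ∀ l X Y X-cycle Y-cycle → X ⊕ Y ≡ M l → ∣ M l ∣ ≤ ∣ X ∣ ⊎ ∣ M l ∣ ≤ ∣ Y ∣
  ⊕≡M⇒∣M∣≤ l X Y X-cycle Y-cycle X⊕Y≡M = coord-⊕≡true⇒∣M∣≤ l X Y X-cycle Y-cycle X⊕Y-cycle
    (trans (coord-cong l X⊕Y-cycle (M-cycle l) X⊕Y≡M) (Exchangeable.coord≡true (M-exchangeable l)))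
    where
    X⊕Y-cycle = IsCycle-⊕ X Y X-cycle Y-cycle

  -- X = Z ⊕ (Z ⊕ X), so Z or Z ⊕ X involves M l and is no shorter than M l, hence than X.
  Exchangeable⇒minimal : ∀ {l X} → Exchangeable l X → ∀ Z → IsCycle Z → Z ⊆ᵇ X → ∀ f → lookup Z f ≡ true → Z ≡ X
  Exchangeable⇒minimal {l} {X} ex Z Z-cycle Z⊆X f Zf
    with coord-⊕≡true⇒∣M∣≤ l Z (Z ⊕ X) Z-cycle Z⊕X-cycle Z⊕Z⊕X-cycle
           (trans (coord-cong l Z⊕Z⊕X-cycle isCycle (⊕-cancelˡ Z X)) coord≡true)
    where
    open Exchangeable ex
    Z⊕X-cycle = IsCycle-⊕ Z X Z-cycle isCycle
    Z⊕Z⊕X-cycle = IsCycle-⊕ Z (Z ⊕ X) Z-cycle Z⊕X-cycle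
  ... | inj₁ ∣M∣≤∣Z∣   = ⊆ᵇ∧∣Y∣≤∣X∣⇒≡ Z X Z⊆X (≤-trans (Exchangeable.∣X∣≤∣M∣ ex) ∣M∣≤∣Z∣)
  ... | inj₂ ∣M∣≤∣Z⊕X∣ = ⊥-elim (<⇒≱ ∣Z⊕X∣<∣X∣ (≤-trans (Exchangeable.∣X∣≤∣M∣ ex) ∣M∣≤∣Z⊕X∣))
    where
    ∣Z⊕X∣<∣X∣ : ∣ Z ⊕ X ∣ < ∣ X ∣
    ∣Z⊕X∣<∣X∣ = ⊆ᵇ⇒∣X∣<∣Y∣ (Z ⊕ X) X (⊕-⊆ᵇ Z X X Z⊆X (λ _ Xe → Xe)) f (Z⊆X f Zf)
                  (trans (lookup-⊕ Z X f) (cong₂ _xor_ Zf (Z⊆X f Zf)))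

  record Circuit (X : EdgeSet) (f : Fin m) (a b : Fin n) : Set where
    field
      rest     : Walk b a
      isPath   : IsPath rest
      rest⊆X   : rest ⊆ᵉ X
      X≡f+rest : X ≡ ⁅ f ⁆ ⊕ edges rest
      covers   : ∀ v → v ∈V X → v ∈ᵥ rest

  -- Deleting f from X leaves odd degree exactly at a and b, which yields a path w from b to a
  -- inside X; ⁅ f ⁆ ⊕ edges w is then a nonempty cycle contained in X, so it is X.
  circuit : ∀ {l X f a b} → Exchangeable l X → lookup X f ≡ true → Joins f a b → Circuit X f a b
  circuit {l} {X} {f} {a} {b} ex Xf f:ab =
    record { rest = w ; isPath = Shortcut.isPath short ; rest⊆X = w⊆X ; X≡f+rest = X≡Z ; covers = covers }
    where
    open Exchangeable ex
    Y = ⁅ f ⁆ ⊕ X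
    Y⊆X : Y ⊆ᵇ X
    Y⊆X = ⊕-⊆ᵇ ⁅ f ⁆ X X (⁅⁆⊆ᵇ X Xf) (λ _ Xe → Xe)
    oddY : ∀ v → oddDeg Y v ≡ (b ≡ᵇ v) xor (a ≡ᵇ v)
    oddY v = begin
      oddDeg (⁅ f ⁆ ⊕ X) v                   ≡⟨ oddDeg-⊕ ⁅ f ⁆ X v ⟩
      oddDeg ⁅ f ⁆ v xor oddDeg X v          ≡⟨ cong₂ _xor_ (oddDeg-⁅⁆ v f:ab) (IsCycle⇒¬oddDeg X isCycle v) ⟩
      ((a ≡ᵇ v) xor (b ≡ᵇ v)) xor false      ≡⟨ xor-identityʳ _ ⟩
      (a ≡ᵇ v) xor (b ≡ᵇ v)                  ≡⟨ xor-comm (a ≡ᵇ v) (b ≡ᵇ v) ⟩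
      (b ≡ᵇ v) xor (a ≡ᵇ v)                  ∎
      where open ≡-Reasoning
    walk  = oddEnds⇒walk Y oddY
    short = shortcut (proj₁ walk)
    w     = Shortcut.path short
    w⊆Y : w ⊆ᵉ Y
    w⊆Y g g∈w = proj₂ walk g (Shortcut.⊆ₑ short g g∈w)
    w⊆X : w ⊆ᵉ X
    w⊆X g g∈w = Y⊆X g (w⊆Y g g∈w)
    f∉w : lookup (edges w) f ≡ false
    f∉w = ∉ₑ⇒edges w λ f∈w → true≢false (trans (sym (w⊆Y f f∈w)) (trans (lookup-⁅⁆⊕-same f X) (cong not Xf)))
    Z = ⁅ f ⁆ ⊕ edges w
    Z-cycle : IsCycle Z
    Z-cycle = ¬oddDeg⇒IsCycle Z λ v → begin
      oddDeg (⁅ f ⁆ ⊕ edges w) v                          ≡⟨ oddDeg-⊕ ⁅ f ⁆ (edges w) v ⟩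
      oddDeg ⁅ f ⁆ v xor oddDeg (edges w) v               ≡⟨ cong₂ _xor_ (oddDeg-⁅⁆ v f:ab) (oddDeg-edges w v) ⟩
      ((a ≡ᵇ v) xor (b ≡ᵇ v)) xor ((b ≡ᵇ v) xor (a ≡ᵇ v)) ≡⟨ xor-telescope (a ≡ᵇ v) (b ≡ᵇ v) (a ≡ᵇ v) ⟩
      (a ≡ᵇ v) xor (a ≡ᵇ v)                               ≡⟨ xor-same (a ≡ᵇ v) ⟩
      false                                               ∎
      where open ≡-Reasoning
    Z⊆X : Z ⊆ᵇ X
    Z⊆X = ⊕-⊆ᵇ ⁅ f ⁆ (edges w) X (⁅⁆⊆ᵇ X Xf) (⊆ᵉ⇒edges⊆ᵇ {W = X} w w⊆X)
    X≡Z : X ≡ Z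
    X≡Z = sym (Exchangeable⇒minimal ex Z Z-cycle Z⊆X f (trans (lookup-⁅⁆⊕-same f (edges w)) (cong not f∉w)))
    covers : ∀ v → v ∈V X → v ∈ᵥ w
    covers v (g , g∈X , v~g) with f ≟ g
    ... | yes refl with Joins∧Incident⇒≡ f:ab v~g
    ...   | inj₁ refl = last∈ᵥ w
    ...   | inj₂ refl = first∈ᵥ w
    covers v (g , g∈X , v~g) | no f≢g = ∈ₑ∧Incident⇒∈ᵥ w (edges⇒∈ₑ w g∈w) v~g
      where
      g∈w : lookup (edges w) g ≡ true
      g∈w = trans (sym (lookup-⁅⁆⊕-≢ (edges w) f≢g)) (trans (cong (λ S → lookup S g) (sym X≡Z)) ([]=⇒lookup g∈X))

-- Rerouting C₁ along C₂

module Rerouting (G : Graph) {k} (M : Fin k → Graph.EdgeSet G) (M-mcb : IsMCB G M) (i j : Fin k) (i≢j : i ≢ j) where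
  open Graph G
  open Edges G
  open CycleParity G
  open Walks G
  open MinimumBasis G M M-mcb

  C₂ : EdgeSet
  C₂ = M j

  coord-i-C₂ : coord i C₂ (M-cycle j) ≡ false
  coord-i-C₂ = trans (coord-basis i j) (dec-false (j ≟ i) (i≢j ∘ sym))

  Goal : Set
  Goal = ∃[ C₁' ] (IsCycle C₁' × IsMCB G (replaceAt M i C₁') × IntersectionIsPath G C₁' C₂)

  record Candidate (D : EdgeSet) : Set where
    field
      exchangeable : Exchangeable i D
      {u v}        : Fin n
      u≢v          : u ≢ v
      u∈D          : u ∈V D
      v∈D          : v ∈V D
      u∈C₂         : u ∈V C₂
      v∈C₂         : v ∈V C₂

  Improvement : EdgeSet → Set
  Improvement D = ∃[ D' ] (Candidate D' × ∣ D ∩ C₂ ∣ < ∣ D' ∩ C₂ ∣)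

  edgeOffC₂ : ∀ {D} → Candidate D → ∃[ f ] (lookup D f ≡ true × lookup C₂ f ≡ false)
  edgeOffC₂ {D} cand with any? (λ f → (lookup D f Bool.≟ true) ×-dec (lookup C₂ f Bool.≟ false))
  ... | yes found = found
  ... | no none   = ⊥-elim (true≢false (begin
    true                          ≡⟨ coord≡true ⟨
    coord i D isCycle             ≡⟨ coord-cong i isCycle (M-cycle j) D≡C₂ ⟩
    coord i C₂ (M-cycle j)        ≡⟨ coord-i-C₂ ⟩
    false                         ∎))
    where
    open ≡-Reasoning
    open Candidate cand
    open Exchangeable exchangeable
    D⊆C₂ : D ⊆ᵇ C₂
    D⊆C₂ f Df with lookup C₂ f in C₂f
    ... | true  = refl
    ... | false = ⊥-elim (none (f , Df , C₂f))
    D≡C₂ : D ≡ C₂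
    D≡C₂ = Exchangeable⇒minimal (M-exchangeable j) D isCycle D⊆C₂ (proj₁ u∈D) ([]=⇒lookup (proj₁ (proj₂ u∈D)))

  record Ear (D : EdgeSet) : Set where
    field
      {x y}         : Fin n
      path          : Walk y x
      isPath        : IsPath path
      x≢y           : x ≢ y
      x∈C₂          : x ∈V C₂
      y∈C₂          : y ∈V C₂
      path⊆D        : path ⊆ᵉ D
      offC₂         : ∀ g → g ∈ₑ path → lookup C₂ g ≡ false
      meetsC₂AtEnds : ∀ v → v ∈ᵥ path → v ∈V C₂ → v ≡ x ⊎ v ≡ y

  module _ {D} (cand : Candidate D) {f} (Df : lookup D f ≡ true) (C₂f : lookup C₂ f ≡ false) where
    open Candidate cand
    private
      a = proj₁ (ends f)
      b = proj₂ (ends f)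
      f:ab : Joins f a b
      f:ab = inj₁ refl
      open Circuit (circuit exchangeable Df f:ab)

    -- The ear runs from the last vertex y of `rest` on C₂, through f, to the first one x.
    earFromHits : (h₁ : FirstHit (_∈V C₂) rest) → LastHit (_∈V C₂) (FirstHit.after h₁) → Ear D
    earFromHits h₁ h₂ = record
      { path = Shortcut.path short ; isPath = Shortcut.isPath short ; x≢y = x≢y ; x∈C₂ = x∈C₂ ; y∈C₂ = y∈C₂
      ; path⊆D = λ g g∈P → P₀⊆D g (Shortcut.⊆ₑ short g g∈P)
      ; offC₂ = λ g g∈P → P₀-offC₂ g (Shortcut.⊆ₑ short g g∈P)
      ; meetsC₂AtEnds = λ v v∈P → P₀-meetsC₂AtEnds v (Shortcut.⊆ᵥ short v v∈P) }
      where
      open FirstHit h₁ renaming (hit to x; P-hit to x∈C₂; before to w₁; after to w'; split to rest≡w₁++w'; first to firstOnC₂)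
      open LastHit h₂ renaming (hit to y; P-hit to y∈C₂; before to wₘ; after to w₃; split to w'≡wₘ++w₃; last to lastOnC₂)

      P₀ : Walk y x
      P₀ = w₃ ++ f ∷⟨ f:ab ⟩ w₁
      short = shortcut P₀

      w₁⊆rest : ∀ g → g ∈ₑ w₁ → g ∈ₑ rest
      w₁⊆rest g g∈w₁ = subst (g ∈ₑ_) (sym rest≡w₁++w') (∈ₑ-++⁺ˡ w₁ w' g∈w₁)
      w₃⊆rest : ∀ g → g ∈ₑ w₃ → g ∈ₑ rest
      w₃⊆rest g g∈w₃ =
        subst (g ∈ₑ_) (sym rest≡w₁++w') (∈ₑ-++⁺ʳ w₁ w' (subst (g ∈ₑ_) (sym w'≡wₘ++w₃) (∈ₑ-++⁺ʳ wₘ w₃ g∈w₃)))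

      P₀⊆D : P₀ ⊆ᵉ D
      P₀⊆D g g∈P₀ with ∈ₑ-++⁻ w₃ _ g∈P₀
      ... | inj₁ g∈w₃         = rest⊆X g (w₃⊆rest g g∈w₃)
      ... | inj₂ (inj₁ refl)  = Df
      ... | inj₂ (inj₂ g∈w₁)  = rest⊆X g (w₁⊆rest g g∈w₁)

      P₀-offC₂ : ∀ g → g ∈ₑ P₀ → lookup C₂ g ≡ false
      P₀-offC₂ g g∈P₀ with ∈ₑ-++⁻ w₃ _ g∈P₀
      ... | inj₁ g∈w₃         = meetsOnce⇒noEdgeIn w₃ lastOnC₂ g g∈w₃
      ... | inj₂ (inj₁ refl)  = C₂f
      ... | inj₂ (inj₂ g∈w₁)  = meetsOnce⇒noEdgeIn w₁ firstOnC₂ g g∈w₁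

      P₀-meetsC₂AtEnds : ∀ v → v ∈ᵥ P₀ → v ∈V C₂ → v ≡ x ⊎ v ≡ y
      P₀-meetsC₂AtEnds v v∈P₀ v∈C₂ with ∈ᵥ-++⁻ w₃ _ v∈P₀
      ... | inj₁ v∈w₃        = inj₂ (lastOnC₂ v v∈w₃ v∈C₂)
      ... | inj₂ (inj₁ refl) = inj₂ (lastOnC₂ v (last∈ᵥ w₃) v∈C₂)
      ... | inj₂ (inj₂ v∈w₁) = inj₁ (firstOnC₂ v v∈w₁ v∈C₂)

      w'-path : IsPath w'
      w'-path = proj₁ (proj₂ (IsPath-++⁻ w₁ w' (subst IsPath rest≡w₁++w' isPath)))

      wₘ-path : IsPath wₘ
      wₘ-path = proj₁ (IsPath-++⁻ wₘ w₃ (subst IsPath w'≡wₘ++w₃ w'-path))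

      x≡y⇒onlyX : x ≡ y → ∀ t → t ∈V D → t ∈V C₂ → t ≡ x
      x≡y⇒onlyX x≡y t t∈D t∈C₂ with ∈ᵥ-++⁻ w₁ w' (subst (t ∈ᵥ_) rest≡w₁++w' (covers t t∈D))
      ... | inj₁ t∈w₁ = firstOnC₂ t t∈w₁ t∈C₂
      ... | inj₂ t∈w' with ∈ᵥ-++⁻ wₘ w₃ (subst (t ∈ᵥ_) w'≡wₘ++w₃ t∈w')
      ...   | inj₁ t∈wₘ = closedPath⇒∈ᵥ⇒≡ wₘ x≡y wₘ-path t∈wₘ
      ...   | inj₂ t∈w₃ = trans (lastOnC₂ t t∈w₃ t∈C₂) (sym x≡y)

      x≢y : x ≢ y
      x≢y x≡y = u≢v (trans (x≡y⇒onlyX x≡y u u∈D u∈C₂) (sym (x≡y⇒onlyX x≡y v v∈D v∈C₂)))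

    earThrough : Ear D
    earThrough with firstHit (_∈V? C₂) rest
    ... | inj₁ avoids = ⊥-elim (avoids u (covers u u∈D) u∈C₂)
    ... | inj₂ h₁ with lastHit (_∈V? C₂) (FirstHit.after h₁)
    ...   | inj₁ avoids = ⊥-elim (avoids _ (first∈ᵥ (FirstHit.after h₁)) (FirstHit.P-hit h₁))
    ...   | inj₂ h₂     = earFromHits h₁ h₂

  ear : ∀ {D} → Candidate D → Ear D
  ear cand = let f , Df , C₂f = edgeOffC₂ cand in earThrough cand Df C₂f

  record Arcs (x y : Fin n) : Set where
    field
      R      : Walk x y
      S      : Walk y x
      R-path : IsPath R
      S-path : IsPath S
      R⊆C₂   : R ⊆ᵉ C₂
      S⊆C₂   : S ⊆ᵉ C₂
      R⊕S≡C₂ : edges R ⊕ edges S ≡ C₂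

  arcs : ∀ {x y} → x ≢ y → x ∈V C₂ → y ∈V C₂ → Arcs x y
  arcs {x} {y} x≢y (g , g∈C₂ , x~g) y∈C₂ = splitAt (firstHit (_≟ y) rest)
    where
    b = proj₁ (Incident⇒Joins x~g)
    g:xb = proj₂ (Incident⇒Joins x~g)
    open Circuit (circuit (M-exchangeable j) ([]=⇒lookup g∈C₂) g:xb)

    splitAt : Avoids (_≡ y) rest ⊎ FirstHit (_≡ y) rest → Arcs x y
    splitAt (inj₁ avoids) = ⊥-elim (avoids y (covers y y∈C₂) refl)
    splitAt (inj₂ record { P-hit = refl ; before = r ; after = S ; split = rest≡r++S }) = record
      { R = g ∷⟨ g:xb ⟩ r ; S = S
      ; R-path = (λ x∈r → x≢y (meet x x∈r (last∈ᵥ S))) , r-path ; S-path = S-path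
      ; R⊆C₂ = λ { _ (inj₁ refl) → []=⇒lookup g∈C₂
                 ; h (inj₂ h∈r) → rest⊆X h (subst (h ∈ₑ_) (sym rest≡r++S) (∈ₑ-++⁺ˡ r S h∈r)) }
      ; S⊆C₂ = λ h h∈S → rest⊆X h (subst (h ∈ₑ_) (sym rest≡r++S) (∈ₑ-++⁺ʳ r S h∈S))
      ; R⊕S≡C₂ = begin
          (⁅ g ⁆ ⊕ edges r) ⊕ edges S ≡⟨ ⊕-assoc ⁅ g ⁆ (edges r) (edges S) ⟩
          ⁅ g ⁆ ⊕ (edges r ⊕ edges S) ≡⟨ cong (⁅ g ⁆ ⊕_) (edges-++ r S) ⟨
          ⁅ g ⁆ ⊕ edges (r ++ S)      ≡⟨ cong (λ w → ⁅ g ⁆ ⊕ edges w) rest≡r++S ⟨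
          ⁅ g ⁆ ⊕ edges rest          ≡⟨ X≡f+rest ⟨
          C₂                          ∎ }
      where
      open ≡-Reasoning
      r-path = proj₁ (IsPath-++⁻ r S (subst IsPath rest≡r++S isPath))
      S-path = proj₁ (proj₂ (IsPath-++⁻ r S (subst IsPath rest≡r++S isPath)))
      meet = proj₂ (proj₂ (IsPath-++⁻ r S (subst IsPath rest≡r++S isPath)))

  module Reroute {D} (cand : Candidate D) (E : Ear D) where
    open Candidate cand
    open Exchangeable exchangeable
    open Ear E hiding (isPath)
    open Arcs (arcs x≢y x∈C₂ y∈C₂)

    Pe : EdgeSet
    Pe = edges path

    Pe⊆D : Pe ⊆ᵇ D
    Pe⊆D = ⊆ᵉ⇒edges⊆ᵇ {W = D} path path⊆D

    C₂#Pe : Disjoint C₂ Pe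
    C₂#Pe = Disjoint-sym Pe C₂ λ g Peg → offC₂ g (edges⇒∈ₑ path Peg)

    Q : EdgeSet
    Q = D ⊕ Pe

    record Arc : Set where
      field
        {s t}     : Fin n
        walk      : Walk s t
        walk-path : IsPath walk
        s≢t       : s ≢ t
        walk⊆C₂   : walk ⊆ᵉ C₂
        closesEar : IsCycle (Pe ⊕ edges walk)
        coversEar : ∀ v → v ∈ᵥ path → v ∈V C₂ → v ∈ᵥ walk

    arcR : Arc
    arcR = record
      { walk = R ; walk-path = R-path ; s≢t = x≢y ; walk⊆C₂ = R⊆C₂
      ; closesEar = sameEnds⇒IsCycle path R (λ v → xor-comm (y ≡ᵇ v) (x ≡ᵇ v))
      ; coversEar = λ v v∈P v∈C₂ →
          [ (λ { refl → first∈ᵥ R }) , (λ { refl → last∈ᵥ R }) ] (meetsC₂AtEnds v v∈P v∈C₂) }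

    arcS : Arc
    arcS = record
      { walk = S ; walk-path = S-path ; s≢t = x≢y ∘ sym ; walk⊆C₂ = S⊆C₂
      ; closesEar = sameEnds⇒IsCycle path S (λ v → refl)
      ; coversEar = λ v v∈P v∈C₂ →
          [ (λ { refl → last∈ᵥ S }) , (λ { refl → first∈ᵥ S }) ] (meetsC₂AtEnds v v∈P v∈C₂) }

    module _ (T : Arc) where
      open Arc T

      private
        Te = edges walk
        A  = Pe ⊕ Te

        Pe#Te : Disjoint Pe Te
        Pe#Te g Peg with lookup Te g in Teg
        ... | false = refl
        ... | true  = ⊥-elim (true≢false (trans (sym C₂g) (Disjoint-sym C₂ Pe C₂#Pe g Peg)))
          where C₂g = ⊆ᵉ⇒edges⊆ᵇ {W = C₂} walk walk⊆C₂ g Teg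

        lookup-A-offPe : ∀ g → lookup Pe g ≡ false → lookup A g ≡ lookup Te g
        lookup-A-offPe g Peg = trans (lookup-⊕ Pe Te g) (cong (_xor lookup Te g) Peg)

        walk⊆A : ∀ g → g ∈ₑ walk → lookup A g ≡ true
        walk⊆A g g∈T = trans (lookup-A-offPe g (C₂#Pe g (walk⊆C₂ g g∈T))) (IsPath∧∈ₑ⇒edges walk walk-path g∈T)

      ∣Pe⊕Te∣≡∣Pe∣+∣Te∣ : ∣ Pe ⊕ edges walk ∣ ≡ ∣ Pe ∣ + ∣ edges walk ∣
      ∣Pe⊕Te∣≡∣Pe∣+∣Te∣ = Disjoint⇒∣X⊕Y∣≡∣X∣+∣Y∣ Pe Te Pe#Te

      ∣D⊕Pe⊕Te∣≤∣Q∣+∣Te∣ : ∣ D ⊕ (Pe ⊕ edges walk) ∣ ≤ ∣ Q ∣ + ∣ edges walk ∣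
      ∣D⊕Pe⊕Te∣≤∣Q∣+∣Te∣ = subst (λ X → ∣ X ∣ ≤ ∣ Q ∣ + ∣ Te ∣) (⊕-assoc D Pe Te) (∣X⊕Y∣≤∣X∣+∣Y∣ Q Te)

      finish : coord i (Pe ⊕ edges walk) closesEar ≡ true → ∣ edges walk ∣ ≤ ∣ Q ∣ → Goal
      finish A-i ∣Te∣≤∣Q∣ =
        A , closesEar , Exchangeable⇒IsMCB A-exchangeable , IsPath⇒IntersectionIsPath walk walk-path vertices edges'
        where
        A-exchangeable : Exchangeable i A
        A-exchangeable = record { isCycle = closesEar ; coord≡true = A-i ; ∣X∣≤∣M∣ = begin
          ∣ A ∣           ≡⟨ ∣Pe⊕Te∣≡∣Pe∣+∣Te∣ ⟩
          ∣ Pe ∣ + ∣ Te ∣ ≤⟨ +-monoʳ-≤ ∣ Pe ∣ ∣Te∣≤∣Q∣ ⟩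
          ∣ Pe ∣ + ∣ Q ∣  ≡⟨ +-comm ∣ Pe ∣ ∣ Q ∣ ⟩
          ∣ Q ∣ + ∣ Pe ∣  ≡⟨ ⊆ᵇ⇒∣X⊕Y∣+∣Y∣≡∣X∣ D Pe Pe⊆D ⟩
          ∣ D ∣           ≤⟨ ∣X∣≤∣M∣ ⟩
          ∣ M i ∣         ∎ }
          where open ≤-Reasoning

        vertices : ∀ v → (v ∈V A × v ∈V C₂) ⇔ v ∈ᵥ walk
        vertices v = mk⇔ to from
          where
          to : v ∈V A × v ∈V C₂ → v ∈ᵥ walk
          to ((g , g∈A , v~g) , v∈C₂) with lookup Pe g in Peg
          ... | true  = coversEar v (∈ₑ∧Incident⇒∈ᵥ path (edges⇒∈ₑ path Peg) v~g) v∈C₂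
          ... | false = ∈ₑ∧Incident⇒∈ᵥ walk (edges⇒∈ₑ walk (trans (sym (lookup-A-offPe g Peg)) ([]=⇒lookup g∈A))) v~g
          from : v ∈ᵥ walk → v ∈V A × v ∈V C₂
          from v∈T with nonempty⇒incidentEdge walk s≢t v∈T
          ... | g , g∈T , v~g = (g , lookup⇒[]= g A (walk⊆A g g∈T) , v~g) , (g , lookup⇒[]= g C₂ (walk⊆C₂ g g∈T) , v~g)

        edges' : ∀ e → e ∈ A ∩ C₂ ⇔ e ∈ₑ walk
        edges' e = mk⇔ to from
          where
          to : e ∈ A ∩ C₂ → e ∈ₑ walk
          to e∈A∩C₂ = edges⇒∈ₑ walk (trans (sym (lookup-A-offPe e (C₂#Pe e C₂e))) Ae)
            where
            A∧C₂ = trans (sym (lookup-∩ A C₂ e)) ([]=⇒lookup e∈A∩C₂)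
            Ae  = ∧-conicalˡ _ _ A∧C₂
            C₂e = ∧-conicalʳ _ _ A∧C₂
          from : e ∈ₑ walk → e ∈ A ∩ C₂
          from e∈T = lookup⇒[]= e (A ∩ C₂) (trans (lookup-∩ A C₂ e) (cong₂ Bool._∧_ (walk⊆A e e∈T) (walk⊆C₂ e e∈T)))

      advance : coord i (Pe ⊕ edges walk) closesEar ≡ false → ∣ edges walk ∣ ≤ ∣ Pe ∣ → Improvement D
      advance A-i ∣Te∣≤∣Pe∣ = D' , candidate' , growth
        where
        D' = D ⊕ A
        D'-cycle = IsCycle-⊕ D A isCycle closesEar

        D'-i : coord i D' D'-cycle ≡ true
        D'-i = trans (coord-⊕ i D A isCycle closesEar D'-cycle) (cong₂ _xor_ coord≡true A-i)

        D'≡Q⊕Te : D' ≡ Q ⊕ Te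
        D'≡Q⊕Te = sym (⊕-assoc D Pe Te)

        -- Since D' involves M i, |M i| ≤ |D'|, so this forces Q ∩ Te = ⊥ and |D'| ≤ |M i|.
        bound : ∣ D' ∣ + 2 * ∣ Q ∩ Te ∣ ≤ ∣ M i ∣
        bound = begin
          ∣ D' ∣ + 2 * ∣ Q ∩ Te ∣     ≡⟨ cong (λ X → ∣ X ∣ + 2 * ∣ Q ∩ Te ∣) D'≡Q⊕Te ⟩
          ∣ Q ⊕ Te ∣ + 2 * ∣ Q ∩ Te ∣ ≡⟨ ∣X⊕Y∣+2∣X∩Y∣≡∣X∣+∣Y∣ Q Te ⟩
          ∣ Q ∣ + ∣ Te ∣              ≤⟨ +-monoʳ-≤ ∣ Q ∣ ∣Te∣≤∣Pe∣ ⟩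
          ∣ Q ∣ + ∣ Pe ∣              ≡⟨ ⊆ᵇ⇒∣X⊕Y∣+∣Y∣≡∣X∣ D Pe Pe⊆D ⟩
          ∣ D ∣                       ≤⟨ ∣X∣≤∣M∣ ⟩
          ∣ M i ∣                     ∎
          where open ≤-Reasoning

        Q#Te : Disjoint Q Te
        Q#Te e Qe with lookup Te e in Tee
        ... | false = refl
        ... | true  = ⊥-elim (n≮0 (subst (0 <_) ∣Q∩Te∣≡0 (0<∣X∣ (Q ∩ Te) e Q∩Te-e)))
          where
          Q∩Te-e = trans (lookup-∩ Q Te e) (cong₂ Bool._∧_ Qe Tee)
          ∣Q∩Te∣≡0 : ∣ Q ∩ Te ∣ ≡ 0
          ∣Q∩Te∣≡0 = m+2n≤m⇒n≡0 ∣ D' ∣ _ (≤-trans bound (coord≡true⇒∣M∣≤∣X∣ i D' D'-cycle D'-i))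

        lookup-D : ∀ e → lookup D e ≡ lookup Q e xor lookup Pe e
        lookup-D e = trans (cong (λ X → lookup X e) (sym (⊕-cancelʳ D Pe))) (lookup-⊕ Q Pe e)

        lookup-D' : ∀ e → lookup D' e ≡ lookup Q e xor lookup Te e
        lookup-D' e = trans (cong (λ X → lookup X e) D'≡Q⊕Te) (lookup-⊕ Q Te e)

        Te#D : Disjoint Te D
        Te#D e Tee = trans (lookup-D e) (cong₂ _xor_ (Disjoint-sym Q Te Q#Te e Tee) (Disjoint-sym Pe Te Pe#Te e Tee))

        Te⊆D' : Te ⊆ᵇ D'
        Te⊆D' e Tee = trans (lookup-D' e) (cong₂ _xor_ (Disjoint-sym Q Te Q#Te e Tee) Tee)

        D∩C₂⊆D'∩C₂ : (D ∩ C₂) ⊆ᵇ (D' ∩ C₂)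
        D∩C₂⊆D'∩C₂ e D∩C₂e = trans (lookup-∩ D' C₂ e) (cong₂ Bool._∧_ D'e C₂e)
          where
          D∧C₂ = trans (sym (lookup-∩ D C₂ e)) D∩C₂e
          C₂e = ∧-conicalʳ (lookup D e) _ D∧C₂
          Qe : lookup Q e ≡ true
          Qe = trans (lookup-⊕ D Pe e) (cong₂ _xor_ (∧-conicalˡ _ (lookup C₂ e) D∧C₂) (C₂#Pe e C₂e))
          D'e = trans (lookup-D' e) (cong₂ _xor_ Qe (Q#Te e Qe))

        onBoth : ∀ z → z ∈ᵥ walk → z ∈V D' × z ∈V C₂
        onBoth z z∈T with nonempty⇒incidentEdge walk s≢t z∈T
        ... | g , g∈T , z~g = (g , lookup⇒[]= g D' (Te⊆D' g (IsPath∧∈ₑ⇒edges walk walk-path g∈T)) , z~g)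
                            , (g , lookup⇒[]= g C₂ (walk⊆C₂ g g∈T) , z~g)

        candidate' : Candidate D'
        candidate' = record
          { exchangeable = record { isCycle = D'-cycle ; coord≡true = D'-i ; ∣X∣≤∣M∣ = ≤-trans (m≤m+n _ _) bound }
          ; u≢v = s≢t
          ; u∈D = proj₁ (onBoth s (first∈ᵥ walk)) ; v∈D = proj₁ (onBoth t (last∈ᵥ walk))
          ; u∈C₂ = proj₂ (onBoth s (first∈ᵥ walk)) ; v∈C₂ = proj₂ (onBoth t (last∈ᵥ walk)) }

        growth : ∣ D ∩ C₂ ∣ < ∣ D' ∩ C₂ ∣
        growth with nonempty⇒incidentEdge walk s≢t (first∈ᵥ walk)
        ... | g , g∈T , _ = ⊆ᵇ⇒∣X∣<∣Y∣ (D ∩ C₂) (D' ∩ C₂) D∩C₂⊆D'∩C₂ g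
              (trans (lookup-∩ D' C₂ g) (cong₂ Bool._∧_ (Te⊆D' g Teg) (walk⊆C₂ g g∈T)))
              (trans (lookup-∩ D C₂ g) (cong (Bool._∧ lookup C₂ g) (Te#D g Teg)))
          where
          Teg = IsPath∧∈ₑ⇒edges walk walk-path g∈T

    private
      AR = Pe ⊕ edges R
      AS = Pe ⊕ edges S
      AR-cycle = Arc.closesEar arcR
      AS-cycle = Arc.closesEar arcS

      ∣C₂∣≡∣R∣+∣S∣ : ∣ C₂ ∣ ≡ ∣ edges R ∣ + ∣ edges S ∣
      ∣C₂∣≡∣R∣+∣S∣ = trans (cong ∣_∣ (sym R⊕S≡C₂)) (Disjoint⇒∣X⊕Y∣≡∣X∣+∣Y∣ (edges R) (edges S) R#S)
        where
        R#S : Disjoint (edges R) (edges S)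
        R#S g Rg = xor≡true⇒¬ʳ R⊕S-g Rg
          where
          R⊕S-g = trans (sym (lookup-⊕ (edges R) (edges S) g))
                        (trans (cong (λ X → lookup X g) R⊕S≡C₂) (⊆ᵉ⇒edges⊆ᵇ {W = C₂} R R⊆C₂ g Rg))

      AR⊕AS≡C₂ : AR ⊕ AS ≡ C₂
      AR⊕AS≡C₂ = begin
        (Pe ⊕ edges R) ⊕ (Pe ⊕ edges S) ≡⟨ ⊕-interchange Pe (edges R) Pe (edges S) ⟩
        (Pe ⊕ Pe) ⊕ (edges R ⊕ edges S) ≡⟨ cong (_⊕ (edges R ⊕ edges S)) (⊕-self Pe) ⟩
        ⊥ ⊕ (edges R ⊕ edges S)         ≡⟨ ⊕-identityˡ _ ⟩
        edges R ⊕ edges S               ≡⟨ R⊕S≡C₂ ⟩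
        C₂                              ∎
        where open ≡-Reasoning

      D⊕AR⊕D⊕AS≡C₂ : (D ⊕ AR) ⊕ (D ⊕ AS) ≡ C₂
      D⊕AR⊕D⊕AS≡C₂ = begin
        (D ⊕ AR) ⊕ (D ⊕ AS) ≡⟨ ⊕-interchange D AR D AS ⟩
        (D ⊕ D) ⊕ (AR ⊕ AS) ≡⟨ cong (_⊕ (AR ⊕ AS)) (⊕-self D) ⟩
        ⊥ ⊕ (AR ⊕ AS)       ≡⟨ ⊕-identityˡ _ ⟩
        AR ⊕ AS             ≡⟨ AR⊕AS≡C₂ ⟩
        C₂                  ∎
        where open ≡-Reasoning

      coord-AR≡coord-AS : coord i AR AR-cycle ≡ coord i AS AS-cycle
      coord-AR≡coord-AS = xor≡false⇒≡ (begin
        coord i AR AR-cycle xor coord i AS AS-cycle ≡⟨ coord-⊕ i AR AS AR-cycle AS-cycle AR⊕AS-cycle ⟨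
        coord i (AR ⊕ AS) AR⊕AS-cycle              ≡⟨ coord-cong i AR⊕AS-cycle (M-cycle j) AR⊕AS≡C₂ ⟩
        coord i C₂ (M-cycle j)                     ≡⟨ coord-i-C₂ ⟩
        false                                      ∎)
        where
        open ≡-Reasoning
        AR⊕AS-cycle = IsCycle-⊕ AR AS AR-cycle AS-cycle

      ∣S∣≤ : ∀ a → ∣ C₂ ∣ ≤ a + ∣ edges R ∣ → ∣ edges S ∣ ≤ a
      ∣S∣≤ a ∣C₂∣≤ = +-cancelˡ-≤ ∣ edges R ∣ _ _ (subst₂ _≤_ ∣C₂∣≡∣R∣+∣S∣ (+-comm a _) ∣C₂∣≤)

      ∣R∣≤ : ∀ a → ∣ C₂ ∣ ≤ a + ∣ edges S ∣ → ∣ edges R ∣ ≤ a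
      ∣R∣≤ a ∣C₂∣≤ = +-cancelʳ-≤ ∣ edges S ∣ _ _ (subst (_≤ a + ∣ edges S ∣) ∣C₂∣≡∣R∣+∣S∣ ∣C₂∣≤)

    -- AR ⊕ AS and (D ⊕ AR) ⊕ (D ⊕ AS) both equal C₂, so one summand of each pair is at least
    -- |C₂| = |R| + |S| long, which bounds the other arc.
    reroute : Goal ⊎ Improvement D
    reroute with coord i AR AR-cycle in AR-i
    ... | true  = inj₁ ([ finishS , finishR ] (⊕≡M⇒∣M∣≤ j (D ⊕ AR) (D ⊕ AS) D⊕AR-cycle D⊕AS-cycle D⊕AR⊕D⊕AS≡C₂))
      where
      D⊕AR-cycle = IsCycle-⊕ D AR isCycle AR-cycle
      D⊕AS-cycle = IsCycle-⊕ D AS isCycle AS-cycle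
      finishS : ∣ C₂ ∣ ≤ ∣ D ⊕ AR ∣ → Goal
      finishS ∣C₂∣≤ =
        finish arcS (trans (sym coord-AR≡coord-AS) AR-i) (∣S∣≤ ∣ Q ∣ (≤-trans ∣C₂∣≤ (∣D⊕Pe⊕Te∣≤∣Q∣+∣Te∣ arcR)))
      finishR : ∣ C₂ ∣ ≤ ∣ D ⊕ AS ∣ → Goal
      finishR ∣C₂∣≤ = finish arcR AR-i (∣R∣≤ ∣ Q ∣ (≤-trans ∣C₂∣≤ (∣D⊕Pe⊕Te∣≤∣Q∣+∣Te∣ arcS)))
    ... | false = inj₂ ([ advanceS , advanceR ] (⊕≡M⇒∣M∣≤ j AR AS AR-cycle AS-cycle AR⊕AS≡C₂))
      where
      advanceS : ∣ C₂ ∣ ≤ ∣ AR ∣ → Improvement D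
      advanceS ∣C₂∣≤ =
        advance arcS (trans (sym coord-AR≡coord-AS) AR-i) (∣S∣≤ ∣ Pe ∣ (subst (∣ C₂ ∣ ≤_) (∣Pe⊕Te∣≡∣Pe∣+∣Te∣ arcR) ∣C₂∣≤))
      advanceR : ∣ C₂ ∣ ≤ ∣ AS ∣ → Improvement D
      advanceR ∣C₂∣≤ = advance arcR AR-i (∣R∣≤ ∣ Pe ∣ (subst (∣ C₂ ∣ ≤_) (∣Pe⊕Te∣≡∣Pe∣+∣Te∣ arcS) ∣C₂∣≤))

  search : ∀ {D} → Acc _<_ (∣ C₂ ∣ ∸ ∣ D ∩ C₂ ∣) → Candidate D → Goal
  search {D} (acc smaller) cand = [ id , continue ] (Reroute.reroute cand (ear cand))
    where
    continue : Improvement D → Goal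
    continue (D' , cand' , growth) = search (smaller (∸-monoʳ-< growth (∣p∩q∣≤∣q∣ D' C₂))) cand'

open Graph

theorem4 : (G : Graph) {k : ℕ} (M : Fin k → EdgeSet G) → IsMCB G M →
    (i j : Fin k) → i ≢ j →
    (∃[ u ] ∃[ v ] (u ≢ v × _∈V_ G u (M i) × _∈V_ G v (M i) × _∈V_ G u (M j) × _∈V_ G v (M j))) →
    ∃[ C₁' ] (IsCycle G C₁' × IsMCB G (replaceAt M i C₁') × IntersectionIsPath G C₁' (M j))
theorem4 G M M-mcb i j i≢j (u , v , u≢v , u∈Mi , v∈Mi , u∈Mj , v∈Mj) =
  search (<-wellFounded _) (record
    { exchangeable = M-exchangeable i ; u≢v = u≢v ; u∈D = u∈Mi ; v∈D = v∈Mi ; u∈C₂ = u∈Mj ; v∈C₂ = v∈Mj })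
  where
  open MinimumBasis G M M-mcb
  open Rerouting G M M-mcb i j i≢j
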